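{- Let $h$ be a random tornado tabulation hash function with $d$ derived characters, $\varphi$ a selector, and $S_i,\mathcal J,f$ as in the context. Then for every integer $i\ge1$, \[ \mathbb E\big[S_i\cdot\mathbf 1[\mathcal J]\big]\le\bar\mu_i=|\Sigma|\cdot\frac{f^i}{i!}. \]
   Context: $\Sigma$ is identified with $k$-bit strings under XOR, $\mathcal R=[2^r]$ with $r$-bit strings. Simple tabulation $g:\Sigma^m\to\mathcal R'$: independent fully random tables, $g(y)=\bigoplus_jT_j[y_j]$. Tornado tabulation with $d$ derived characters: derived key $\tilde x\in\Sigma^{c+d}$ of $x=x_1\cdots x_c$ has $\tilde x_i=x_i$ ($i<c$), $\tilde x_c=x_c\oplus h_0(x_1\cdots x_{c-1})$, $\tilde x_{c+i}=\tilde h_i(\tilde x_1\cdots\tilde x_{c+i-1})$ ($1\le i\le d$), $h_0,\tilde h_i$ simple tabulation into $\Sigma$; $h(x)=\hat h(\tilde x)$ for simple tabulation $\hat h$; all tables independent. Selector $\varphi:\Sigma^c\times\mathcal R\to\{0,1\}$, $\varphi(x,r)$ depending only on $x$ and fixed bits of $r$; $X=\{x:\varphi(x,h(x))=1\}$, $\mu=\mathbb E|X|$, $f=\mu/|\Sigma|$. $X_\alpha=\{x\in X:\tilde x_{c+d}=\alpha\}$, $S_i=|\{\alpha\in\Sigma:|X_\alpha|\ge i\}|$. A family of keys (viewed as sets of position characters) is linearly independent if no nonempty subfamily has every position character occurring an even number of times; $\mathcal J$ is the event that $(\tilde x_1\cdots\tilde x_{c+d-1})_{x\in X}$ is linearly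 independent. -}

module Defs where

open import Data.Bool using (Bool; true; false; _xor_; _∧_; not; if_then_else_)
open import Data.Bool.Properties using () renaming (_≟_ to _≟B_)
open import Data.Nat using (ℕ; zero; suc; _^_; _≤ᵇ_; _!)
open import Data.Nat.Properties using (m^n≢0; _!≢0)
open import Data.Fin using (Fin; zero; suc)
open import Data.Vec using (Vec; []; _∷_; _∷ʳ_; init; last; lookup; replicate; zipWith)
open import Data.Vec.Properties using (≡-dec)
open import Data.List as List using (List; []; _∷_; _++_; filterᵇ; null)
open import Data.Nat.ListAction using (sum)
open import Data.Bool.ListAction using (all; any)
open import Data.List.NonEmpty as List⁺ using (List⁺; _∷_; toList; concatMap)
open import Data.Product using (_×_; _,_; proj₁; proj₂)
open import Data.Unit using (⊤; tt)
open import Data.Integer using (+_)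
open import Data.Rational using (ℚ; _/_; _*_; 1ℚ)
open import Relation.Nullary.Decidable using (⌊_⌋)

Bits : ℕ → Set
Bits k = Vec Bool k

Chr : ℕ → Set
Chr k = Bits k

_⊕_ : ∀ {k} → Bits k → Bits k → Bits k
_⊕_ = zipWith _xor_

𝟎 : ∀ {k} → Bits k
𝟎 = replicate _ false

_==_ : ∀ {k} → Bits k → Bits k → Bool
a == b = ⌊ ≡-dec _≟B_ a b ⌋

Tables : ℕ → ℕ → ℕ → Set
Tables m k s = Fin m → Chr k → Bits s

simpleTab : ∀ {m k s} → Tables m k s → Vec (Chr k) m → Bits s
simpleTab {zero}  T []       = 𝟎
simpleTab {suc m} T (y ∷ ys) = T zero y ⊕ simpleTab (λ j → T (suc j)) ys

-- tables of the derived-character functions h̃_1 … h̃_d, the first one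
-- acting on strings of length (suc m)
DerTabs : ℕ → ℕ → ℕ → Set
DerTabs k zero    m = ⊤
DerTabs k (suc d) m = Tables (suc m) k k × DerTabs k d (suc m)

L : ℕ → ℕ → ℕ
L zero    m = m
L (suc d) m = L d (suc m)

-- given prefix p = x̃_1⋯x̃_{j-1} and current last character l = x̃_j,
-- returns (x̃_1⋯x̃_{c+d-1} , x̃_{c+d})
deriveRest : ∀ {k d m} → DerTabs k d m → Vec (Chr k) m → Chr k
           → Vec (Chr k) (L d m) × Chr k
deriveRest {d = zero}  tt       p l = p , l
deriveRest {d = suc d} (t , ts) p l =
  deriveRest ts (p ∷ʳ l) (simpleTab t (p ∷ʳ l))

-- keys x ∈ Σ^c with c = suc c'
Key : ℕ → ℕ → Set
Key k c' = Vec (Chr k) (suc c')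

record Tornado (k r c' d : ℕ) : Set where
  constructor tornado
  field
    h₀   : Tables c' k k
    hder : DerTabs k d c'
    ĥ    : Tables (suc (L d c')) k r

module _ {k r c' d : ℕ} (h : Tornado k r c' d) where
  open Tornado h

  -- (x̃_1⋯x̃_{c+d-1} , x̃_{c+d})
  derived : Key k c' → Vec (Chr k) (L d c') × Chr k
  derived x = deriveRest hder (init x) (last x ⊕ simpleTab h₀ (init x))

  derivedKey : Key k c' → Vec (Chr k) (suc (L d c'))
  derivedKey x = proj₁ (derived x) ∷ʳ proj₂ (derived x)

  hash : Key k c' → Bits r
  hash x = simpleTab ĥ (derivedKey x)

-- Finite enumerations (uniform distributions over nonempty lists).

allBits : ∀ k → List⁺ (Bits k)
allBits zero    = [] ∷ []
allBits (suc k) =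
  concatMap (λ b → List⁺.map (b ∷_) (allBits k)) (false ∷ true ∷ [])

allVecs : ∀ {A : Set} n → List⁺ A → List⁺ (Vec A n)
allVecs zero    as = [] ∷ []
allVecs (suc n) as = concatMap (λ a → List⁺.map (a ∷_) (allVecs n as)) as

allFunsFin : ∀ {B : Set} n → List⁺ B → List⁺ (Fin n → B)
allFunsFin zero    bs = (λ ()) ∷ []
allFunsFin (suc n) bs =
  concatMap (λ b → List⁺.map (λ f → λ { zero → b ; (suc i) → f i })
                             (allFunsFin n bs)) bs

allFunsBits : ∀ {A : Set} k → List⁺ A → List⁺ (Bits k → A)
allFunsBits zero    as = List⁺.map (λ a _ → a) as
allFunsBits (suc k) as =
  concatMap (λ f → List⁺.map (λ g → λ { (false ∷ v) → f v ; (true ∷ v) → g v })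
                             (allFunsBits k as))
            (allFunsBits k as)

allTables : ∀ m k s → List⁺ (Tables m k s)
allTables m k s = allFunsFin m (allFunsBits k (allBits s))

allDerTabs : ∀ k d m → List⁺ (DerTabs k d m)
allDerTabs k zero    m = tt ∷ []
allDerTabs k (suc d) m =
  concatMap (λ t → List⁺.map (t ,_) (allDerTabs k d (suc m)))
            (allTables (suc m) k k)

allTornado : ∀ k r c' d → List⁺ (Tornado k r c' d)
allTornado k r c' d =
  concatMap (λ t₀ → concatMap (λ td → List⁺.map (tornado t₀ td)
                                         (allTables (suc (L d c')) k r))
                              (allDerTabs k d c'))
            (allTables c' k k)

𝔼 : ∀ {Ω : Set} → List⁺ Ω → (Ω → ℕ) → ℚ
𝔼 (ω ∷ ωs) F = (+ sum (List.map F (ω ∷ ωs))) / suc (List.length ωs)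

Selector : ℕ → ℕ → ℕ → Set
Selector k r c' = Key k c' → Bits r → Bool

allKeys : ∀ k c' → List (Key k c')
allKeys k c' = toList (allVecs (suc c') (allBits k))

module _ {k r c' d : ℕ} (φ : Selector k r c') (h : Tornado k r c' d) where

  Xset : List (Key k c')
  Xset = filterᵇ (λ x → φ x (hash h x)) (allKeys k c')

  Xα : Chr k → List (Key k c')
  Xα α = filterᵇ (λ x → proj₂ (derived h x) == α) Xset

  S : ℕ → ℕ
  S i = List.length (filterᵇ (λ α → i ≤ᵇ List.length (Xα α))
                             (toList (allBits k)))

-- Linear independence of a family (list) of keys in Σ^n, viewed as
-- sets of position characters (j , y_j).

evenᵇ : ℕ → Bool
evenᵇ zero          = true
evenᵇ (suc zero)    = false
evenᵇ (suc (suc n)) = evenᵇ n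

count : ∀ {A : Set} → (A → Bool) → List A → ℕ
count p xs = List.length (filterᵇ p xs)

allEven : ∀ {k n} → List (Vec (Chr k) n) → Bool
allEven {k} {n} ys =
  all (λ j → all (λ a → evenᵇ (count (λ y → lookup y j == a) ys))
                           (toList (allBits k)))
           (List.allFin n)

subfamilies : ∀ {A : Set} → List A → List (List A)
subfamilies []       = [] ∷ []
subfamilies (x ∷ xs) = subfamilies xs ++ List.map (x ∷_) (subfamilies xs)

linIndep : ∀ {k n} → List (Vec (Chr k) n) → Bool
linIndep ys =
  not (any (λ zs → not (null zs) ∧ allEven zs) (subfamilies ys))

𝟏𝒥 : ∀ {k r c' d} → Selector k r c' → Tornado k r c' d → ℕ
𝟏𝒥 φ h = if linIndep (List.map (λ x → proj₁ (derived h x)) (Xset φ h))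
         then 1 else 0

_^ℚ_ : ℚ → ℕ → ℚ
q ^ℚ zero  = 1ℚ
q ^ℚ suc n = q * (q ^ℚ n)

fromℕℚ : ℕ → ℚ
fromℕℚ n = (+ n) / 1

inv2^ : ℕ → ℚ
inv2^ k = (+ 1) / (2 ^ k)
  where instance _ = m^n≢0 2 k

inv! : ℕ → ℚ
inv! i = (+ 1) / (i !)
  where instance _ = i !≢0

μ : ∀ k r c' d → Selector k r c' → ℚ
μ k r c' d φ = 𝔼 (allTornado k r c' d) (λ h → List.length (Xset φ h))

fval : ∀ k r c' d → Selector k r c' → ℚ
fval k r c' d φ = μ k r c' d φ * inv2^ k

μ̄ : ∀ k r c' d → Selector k r c' → ℕ → ℚ
μ̄ k r c' d φ i = fromℕℚ (2 ^ k) * (fval k r c' d φ ^ℚ i) * inv! i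

{-# OPTIONS --safe #-}
-- Simple tabulation is a GF(2)-linear map of its table entries, so by Gaussian elimination it is
-- uniformly distributed on keys whose position characters are linearly independent.
-- Fix an i-tuple t of keys with independent prefixes x̃₁⋯x̃_{c+d-1}. The last derived characters of
-- its keys are a fresh simple tabulation of such prefixes (for d = 0: of x₁⋯x_{c-1}, shifted by x_c),
-- so the keys of t share a bucket with probability |Σ|^(1-i); the full derived keys are then
-- independent too, so ĥ selects all of them with probability ∏ₓ Pr[x ∈ X]. On 𝒥 a bucket α with
-- |X_α| ≥ i contains at least i! tuples of distinct keys, whose prefixes are independent as a
-- subfamily of those of X. Summing over tuples, i! 𝔼[Sᵢ 𝟏𝒥] ≤ |Σ|^(1-i) (∑ₓ Pr[x ∈ X])^i = |Σ| f^i.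

module Submission where

open import Defs
open import Data.Bool using (Bool; true; false; _xor_; _∧_; not; if_then_else_; T)
open import Data.Bool.Properties
  using (xor-assoc; xor-comm; xor-same; xor-identityʳ; ∨-identityʳ)
  renaming (_≟_ to _≟B_)
open import Data.Nat using (ℕ; zero; suc; _+_; _*_; _^_; _≤_; z≤n; s≤s; _!; _≤ᵇ_; NonZero)
open import Data.Nat.Properties
  using ( +-identityʳ; +-assoc; +-comm; +-mono-≤; *-identityˡ; *-identityʳ; *-zeroʳ; *-comm; *-assoc
        ; *-distribˡ-+; *-monoˡ-≤; *-cancelʳ-≡; *-cancelʳ-≤; ^-zeroˡ; ≤-trans; ≤-reflexive; ≤-pred; ≤ᵇ⇒≤
        ; m^n≢0; _!≢0; +-commutativeSemigroup; *-commutativeSemigroup; module ≤-Reasoning)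
open import Data.Nat.ListAction using (sum)
import Algebra.Properties.CommutativeSemigroup as CommutativeSemigroupProperties
open import Data.Nat.Tactic.RingSolver using (solve-∀)
open import Data.Fin using (Fin; zero; suc; inject₁)
open import Data.Vec as Vec
  using (Vec; []; _∷_; _∷ʳ_; _++_; init; last; head; tail; lookup; replicate; zipWith; map; insertAt; removeAt)
open import Data.Vec.Properties
  using ( ≡-dec; zipWith-assoc; zipWith-comm; zipWith-identityʳ; zipWith-++
        ; ++-injectiveˡ; ++-injectiveʳ; map-∘; map-insertAt; insertAt-lookup; removeAt-insertAt
        ; insertAt-removeAt; lookup-replicate)
open import Data.List as List using (List; []; _∷_; filterᵇ; null)
import Data.List.Properties as List
open import Data.List.NonEmpty as List⁺ using (List⁺; _∷_; toList; concatMap)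
open import Data.Bool.ListAction using (all; any)
open import Data.Product using (_×_; _,_; proj₁; proj₂; Σ)
open import Data.Sum using (_⊎_; inj₁; inj₂)
open import Data.Unit using (tt)
open import Data.Empty using (⊥-elim)
open import Relation.Nullary using (yes; no)
open import Relation.Nullary.Decidable using (⌊_⌋)
open import Relation.Binary.Definitions using (DecidableEquality)
open import Relation.Binary.PropositionalEquality
open import Function using (_∘_)
import Data.Integer as ℤ
import Data.Integer.Properties as ℤP
open import Data.Rational as ℚ using (ℚ; toℚᵘ) renaming (_≤_ to _≤ℚ_)
import Data.Rational.Properties as ℚP
open import Data.Rational.Unnormalised as U using (ℚᵘ; mkℚᵘ; ↥_; ↧ₙ_)
import Data.Rational.Unnormalised.Properties as UP

module +-CS = CommutativeSemigroupProperties +-commutativeSemigroup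
module *-CS = CommutativeSemigroupProperties *-commutativeSemigroup

⟦_⟧ : Bool → ℕ
⟦ true ⟧  = 1
⟦ false ⟧ = 0

⟦∧⟧ : ∀ a b → ⟦ a ∧ b ⟧ ≡ ⟦ a ⟧ * ⟦ b ⟧
⟦∧⟧ true  b = sym (+-identityʳ ⟦ b ⟧)
⟦∧⟧ false b = refl

∑ : ∀ {A : Set} → List A → (A → ℕ) → ℕ
∑ []       F = 0
∑ (x ∷ xs) F = F x + ∑ xs F

∑⁺ : ∀ {A : Set} → List⁺ A → (A → ℕ) → ℕ
∑⁺ xs F = ∑ (toList xs) F

module _ {A : Set} where

  sum-map≡∑ : ∀ (F : A → ℕ) xs → sum (List.map F xs) ≡ ∑ xs F
  sum-map≡∑ F []       = refl
  sum-map≡∑ F (x ∷ xs) = cong (F x +_) (sum-map≡∑ F xs)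

  ∑-cong : ∀ {F G : A → ℕ} xs → (∀ x → F x ≡ G x) → ∑ xs F ≡ ∑ xs G
  ∑-cong []       F≗G = refl
  ∑-cong (x ∷ xs) F≗G = cong₂ _+_ (F≗G x) (∑-cong xs F≗G)

  ∑-mono-≤ : ∀ {F G : A → ℕ} xs → (∀ x → F x ≤ G x) → ∑ xs F ≤ ∑ xs G
  ∑-mono-≤ []       F≤G = z≤n
  ∑-mono-≤ (x ∷ xs) F≤G = +-mono-≤ (F≤G x) (∑-mono-≤ xs F≤G)

  ∑-++ : ∀ (F : A → ℕ) xs ys → ∑ (xs List.++ ys) F ≡ ∑ xs F + ∑ ys F
  ∑-++ F []       ys = refl
  ∑-++ F (x ∷ xs) ys = trans (cong (F x +_) (∑-++ F xs ys)) (sym (+-assoc (F x) _ _))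

  ∑-+ : ∀ (F G : A → ℕ) xs → ∑ xs (λ x → F x + G x) ≡ ∑ xs F + ∑ xs G
  ∑-+ F G []       = refl
  ∑-+ F G (x ∷ xs) = trans (cong ((F x + G x) +_) (∑-+ F G xs)) (+-CS.interchange (F x) (G x) _ _)

  ∑-*ˡ : ∀ c (F : A → ℕ) xs → ∑ xs (λ x → c * F x) ≡ c * ∑ xs F
  ∑-*ˡ c F []       = sym (*-zeroʳ c)
  ∑-*ˡ c F (x ∷ xs) = trans (cong (c * F x +_) (∑-*ˡ c F xs)) (sym (*-distribˡ-+ c (F x) _))

  ∑-*ʳ : ∀ c (F : A → ℕ) xs → ∑ xs (λ x → F x * c) ≡ ∑ xs F * c
  ∑-*ʳ c F xs = trans (∑-cong xs (λ x → *-comm (F x) c)) (trans (∑-*ˡ c F xs) (*-comm c _))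

  ∑-zero : ∀ (xs : List A) → ∑ xs (λ _ → 0) ≡ 0
  ∑-zero []       = refl
  ∑-zero (x ∷ xs) = ∑-zero xs

  ∑-const : ∀ (xs : List A) c → ∑ xs (λ _ → c) ≡ List.length xs * c
  ∑-const []       c = refl
  ∑-const (x ∷ xs) c = cong (c +_) (∑-const xs c)

  ∑-filterᵇ : ∀ (p : A → Bool) (F : A → ℕ) xs → ∑ (filterᵇ p xs) F ≡ ∑ xs (λ x → ⟦ p x ⟧ * F x)
  ∑-filterᵇ p F []       = refl
  ∑-filterᵇ p F (x ∷ xs) with p x
  ... | true  = cong₂ _+_ (sym (+-identityʳ (F x))) (∑-filterᵇ p F xs)
  ... | false = ∑-filterᵇ p F xs

  length-filterᵇ : ∀ (p : A → Bool) xs → List.length (filterᵇ p xs) ≡ ∑ xs (λ x → ⟦ p x ⟧)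
  length-filterᵇ p xs =
    trans (sym (trans (∑-const (filterᵇ p xs) 1) (*-identityʳ _)))
          (trans (∑-filterᵇ p (λ _ → 1) xs) (∑-cong xs (λ x → *-identityʳ ⟦ p x ⟧)))

module _ {A B : Set} where

  ∑-map : ∀ (f : A → B) (F : B → ℕ) xs → ∑ (List.map f xs) F ≡ ∑ xs (F ∘ f)
  ∑-map f F []       = refl
  ∑-map f F (x ∷ xs) = cong (F (f x) +_) (∑-map f F xs)

  ∑-concatMap : ∀ (f : A → List B) (F : B → ℕ) xs →
    ∑ (List.concatMap f xs) F ≡ ∑ xs (λ x → ∑ (f x) F)
  ∑-concatMap f F []       = refl
  ∑-concatMap f F (x ∷ xs) = trans (∑-++ F (f x) _) (cong (∑ (f x) F +_) (∑-concatMap f F xs))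

  ∑-comm : ∀ (F : A → B → ℕ) (xs : List A) (ys : List B) →
    ∑ xs (λ x → ∑ ys (F x)) ≡ ∑ ys (λ y → ∑ xs (λ x → F x y))
  ∑-comm F []       ys = sym (∑-zero ys)
  ∑-comm F (x ∷ xs) ys = trans (cong (∑ ys (F x) +_) (∑-comm F xs ys)) (sym (∑-+ (F x) _ ys))

  ∑∑-*ʳ : ∀ (xs : List A) (ys : List B) (F : A → B → ℕ) c →
    ∑ xs (λ x → ∑ ys (F x)) * c ≡ ∑ xs (λ x → ∑ ys (λ y → F x y * c))
  ∑∑-*ʳ xs ys F c = trans (sym (∑-*ʳ c (λ x → ∑ ys (F x)) xs)) (∑-cong xs (λ x → sym (∑-*ʳ c (F x) ys)))

  ∑⁺-map : ∀ (f : A → B) (F : B → ℕ) xs → ∑⁺ (List⁺.map f xs) F ≡ ∑⁺ xs (F ∘ f)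
  ∑⁺-map f F (x ∷ xs) = cong (F (f x) +_) (∑-map f F xs)

  ∑⁺-concatMap : ∀ (f : A → List⁺ B) (F : B → ℕ) xs →
    ∑⁺ (concatMap f xs) F ≡ ∑⁺ xs (λ x → ∑⁺ (f x) F)
  ∑⁺-concatMap f F (x ∷ xs) =
    trans (∑-++ F (toList (f x)) _)
          (cong (∑⁺ (f x) F +_)
                (trans (cong (λ xss → ∑ (List.concat xss) F) (sym (List.map-∘ xs)))
                       (∑-concatMap (toList ∘ f) F xs)))

∑⁺-const : ∀ {A : Set} (xs : List⁺ A) c → ∑⁺ xs (λ _ → c) ≡ List⁺.length xs * c
∑⁺-const xs c = ∑-const (toList xs) c

length≡∑⁺ : ∀ {A : Set} (xs : List⁺ A) → List⁺.length xs ≡ ∑⁺ xs (λ _ → 1)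
length≡∑⁺ xs = sym (trans (∑⁺-const xs 1) (*-identityʳ _))

false≢true : false ≢ true
false≢true ()

∧-true-left : ∀ {a b} → (a ∧ b) ≡ true → a ≡ true
∧-true-left {true} _ = refl

∧-true-right : ∀ {a b} → (a ∧ b) ≡ true → b ≡ true
∧-true-right {true} b≡true = b≡true

module _ {A : Set} where

  count≡∑ : ∀ (p : A → Bool) xs → count p xs ≡ ∑ xs (λ x → ⟦ p x ⟧)
  count≡∑ = length-filterᵇ

  count-cong : ∀ {p q : A → Bool} xs → (∀ x → p x ≡ q x) → count p xs ≡ count q xs
  count-cong {p} {q} xs p≗q =
    trans (count≡∑ p xs) (trans (∑-cong xs (λ x → cong ⟦_⟧ (p≗q x))) (sym (count≡∑ q xs)))

  count-map : ∀ {B : Set} (p : B → Bool) (f : A → B) xs → count p (List.map f xs) ≡ count (p ∘ f) xs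
  count-map p f xs = trans (length-filterᵇ p (List.map f xs)) (trans (∑-map f _ xs) (sym (count≡∑ (p ∘ f) xs)))

  count-filterᵇ : ∀ (p q : A → Bool) xs → count p (filterᵇ q xs) ≡ ∑ xs (λ x → ⟦ q x ⟧ * ⟦ p x ⟧)
  count-filterᵇ p q xs = trans (length-filterᵇ p (filterᵇ q xs)) (∑-filterᵇ q (λ x → ⟦ p x ⟧) xs)

  count-true : ∀ (xs : List A) → count (λ _ → true) xs ≡ List.length xs
  count-true []       = refl
  count-true (x ∷ xs) = cong suc (count-true xs)

  null-cong : ∀ (xs ys : List A) → List.length xs ≡ List.length ys → null xs ≡ null ys
  null-cong []      []      _ = refl
  null-cong (_ ∷ _) (_ ∷ _) _ = refl

  all-intro : ∀ (p : A → Bool) xs → (∀ x → p x ≡ true) → all p xs ≡ true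
  all-intro p []       p≡true = refl
  all-intro p (x ∷ xs) p≡true rewrite p≡true x = all-intro p xs p≡true

  all-∧⁻ : ∀ (p q : A → Bool) xs → all (λ x → p x ∧ q x) xs ≡ true → all p xs ≡ true × all q xs ≡ true
  all-∧⁻ p q []       _ = refl , refl
  all-∧⁻ p q (x ∷ xs) all≡true with p x | q x
  ... | true  | true  = all-∧⁻ p q xs all≡true
  all-∧⁻ p q (x ∷ xs) () | true  | false
  all-∧⁻ p q (x ∷ xs) () | false | _

  all-cong : ∀ {p q : A → Bool} xs → (∀ x → p x ≡ q x) → all p xs ≡ all q xs
  all-cong []       p≗q = refl
  all-cong (x ∷ xs) p≗q = cong₂ _∧_ (p≗q x) (all-cong xs p≗q)

  ∑-cong-all : ∀ (q : A → Bool) {F G : A → ℕ} xs → (∀ y → q y ≡ true → F y ≡ G y) →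
    all q xs ≡ true → ∑ xs F ≡ ∑ xs G
  ∑-cong-all q []       F≗G all≡true = refl
  ∑-cong-all q (x ∷ xs) F≗G all≡true with q x in qx
  ... | true = cong₂ _+_ (F≗G x qx) (∑-cong-all q xs F≗G all≡true)

module _ {A : Set} (P : A → Bool) where

  any-++⁺ˡ : ∀ xs ys → any P xs ≡ true → any P (xs List.++ ys) ≡ true
  any-++⁺ˡ (x ∷ xs) ys any≡true with P x
  ... | true  = refl
  ... | false = any-++⁺ˡ xs ys any≡true

  any-++⁺ʳ : ∀ xs ys → any P ys ≡ true → any P (xs List.++ ys) ≡ true
  any-++⁺ʳ []       ys any≡true = any≡true
  any-++⁺ʳ (x ∷ xs) ys any≡true with P x
  ... | true  = refl
  ... | false = any-++⁺ʳ xs ys any≡true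

  any-++⁻ : ∀ xs ys → any P (xs List.++ ys) ≡ true → any P xs ≡ true ⊎ any P ys ≡ true
  any-++⁻ []       ys any≡true = inj₂ any≡true
  any-++⁻ (x ∷ xs) ys any≡true with P x
  ... | true  = inj₁ refl
  ... | false = any-++⁻ xs ys any≡true

module _ {A B : Set} (P : B → Bool) where

  any-map⁺ : ∀ (f : A → B) xs → any (P ∘ f) xs ≡ true → any P (List.map f xs) ≡ true
  any-map⁺ f (x ∷ xs) any≡true with P (f x)
  ... | true  = refl
  ... | false = any-map⁺ f xs any≡true

  any-map⁻ : ∀ (f : A → B) xs → any P (List.map f xs) ≡ true → any (P ∘ f) xs ≡ true
  any-map⁻ f (x ∷ xs) any≡true with P (f x)
  ... | true  = refl
  ... | false = any-map⁻ f xs any≡true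

module _ {k : ℕ} where

  ⊕-assoc : ∀ (a b c : Bits k) → (a ⊕ b) ⊕ c ≡ a ⊕ (b ⊕ c)
  ⊕-assoc = zipWith-assoc xor-assoc

  ⊕-comm : ∀ (a b : Bits k) → a ⊕ b ≡ b ⊕ a
  ⊕-comm = zipWith-comm xor-comm

  ⊕-identityʳ : ∀ (a : Bits k) → a ⊕ 𝟎 ≡ a
  ⊕-identityʳ = zipWith-identityʳ xor-identityʳ

  ⊕-identityˡ : ∀ (a : Bits k) → 𝟎 ⊕ a ≡ a
  ⊕-identityˡ a = trans (⊕-comm 𝟎 a) (⊕-identityʳ a)

  ⊕-interchange : ∀ (a b c d : Bits k) → (a ⊕ b) ⊕ (c ⊕ d) ≡ (a ⊕ c) ⊕ (b ⊕ d)
  ⊕-interchange a b c d = begin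
    (a ⊕ b) ⊕ (c ⊕ d)  ≡⟨ ⊕-assoc a b (c ⊕ d) ⟩
    a ⊕ (b ⊕ (c ⊕ d))  ≡⟨ cong (a ⊕_) (sym (⊕-assoc b c d)) ⟩
    a ⊕ ((b ⊕ c) ⊕ d)  ≡⟨ cong (λ e → a ⊕ (e ⊕ d)) (⊕-comm b c) ⟩
    a ⊕ ((c ⊕ b) ⊕ d)  ≡⟨ cong (a ⊕_) (⊕-assoc c b d) ⟩
    a ⊕ (c ⊕ (b ⊕ d))  ≡⟨ sym (⊕-assoc a c (b ⊕ d)) ⟩
    (a ⊕ c) ⊕ (b ⊕ d)  ∎
    where open ≡-Reasoning

⊕-self : ∀ {k} (a : Bits k) → a ⊕ a ≡ 𝟎
⊕-self []      = refl
⊕-self (x ∷ a) = cong₂ _∷_ (xor-same x) (⊕-self a)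

⊕-++ : ∀ {a b} (u w : Bits a) (u' w' : Bits b) → (u ++ u') ⊕ (w ++ w') ≡ (u ⊕ w) ++ (u' ⊕ w')
⊕-++ u w u' w' = zipWith-++ _xor_ u u' w w'

𝟎-++ : ∀ a b → 𝟎 {a + b} ≡ 𝟎 {a} ++ 𝟎 {b}
𝟎-++ zero    b = refl
𝟎-++ (suc a) b = cong (false ∷_) (𝟎-++ a b)

++-≡𝟎 : ∀ {a b} (u : Bits a) (u' : Bits b) → u ++ u' ≡ 𝟎 → u ≡ 𝟎 × u' ≡ 𝟎
++-≡𝟎 {a} {b} u u' u++u'≡𝟎 = ++-injectiveˡ u 𝟎 eq , ++-injectiveʳ u 𝟎 eq
  where eq = trans u++u'≡𝟎 (𝟎-++ a b)

module BoolEquality {A : Set} (_≟_ : DecidableEquality A) where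

  _≡ᵇ_ : A → A → Bool
  x ≡ᵇ y = ⌊ x ≟ y ⌋

  ≡ᵇ⇒≡ : ∀ {x y} → (x ≡ᵇ y) ≡ true → x ≡ y
  ≡ᵇ⇒≡ {x} {y} _ with x ≟ y
  ≡ᵇ⇒≡ _  | yes x≡y = x≡y
  ≡ᵇ⇒≡ () | no _

  ≡ᵇ-sym : ∀ x y → (x ≡ᵇ y) ≡ (y ≡ᵇ x)
  ≡ᵇ-sym x y with x ≟ y | y ≟ x
  ... | yes _   | yes _   = refl
  ... | no _    | no _    = refl
  ... | yes x≡y | no y≢x  = ⊥-elim (y≢x (sym x≡y))
  ... | no x≢y  | yes y≡x = ⊥-elim (x≢y (sym y≡x))

  EachOnce : List⁺ A → Set
  EachOnce xs = ∀ a → ∑⁺ xs (λ x → ⟦ x ≡ᵇ a ⟧) ≡ 1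

open BoolEquality using () renaming (EachOnce to EachOnce[_])

⌊≡-dec⌋-∷ : ∀ {A : Set} (_≟_ : DecidableEquality A) {n} x y (xs ys : Vec A n) →
  ⌊ ≡-dec _≟_ (x ∷ xs) (y ∷ ys) ⌋ ≡ ⌊ x ≟ y ⌋ ∧ ⌊ ≡-dec _≟_ xs ys ⌋
⌊≡-dec⌋-∷ _≟_ x y xs ys with x ≟ y | ≡-dec _≟_ xs ys
... | yes refl | yes refl = refl
... | yes refl | no _     = refl
... | no _     | _        = refl

module _ {A : Set} where

  ∑-allVecs-suc : ∀ n (xs : List⁺ A) (F : Vec A (suc n) → ℕ) →
    ∑⁺ (allVecs (suc n) xs) F ≡ ∑⁺ xs (λ a → ∑⁺ (allVecs n xs) (λ v → F (a ∷ v)))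
  ∑-allVecs-suc n xs F =
    trans (∑⁺-concatMap (λ a → List⁺.map (a ∷_) (allVecs n xs)) F xs)
          (∑-cong (toList xs) (λ a → ∑⁺-map (a ∷_) F (allVecs n xs)))

  ∑-allVecs-++ : ∀ a b (xs : List⁺ A) (F : Vec A (a + b) → ℕ) →
    ∑⁺ (allVecs (a + b) xs) F ≡ ∑⁺ (allVecs a xs) (λ u → ∑⁺ (allVecs b xs) (λ v → F (u ++ v)))
  ∑-allVecs-++ zero    b xs F = sym (+-identityʳ _)
  ∑-allVecs-++ (suc a) b xs F = begin
    ∑⁺ (allVecs (suc a + b) xs) F
      ≡⟨ ∑-allVecs-suc (a + b) xs F ⟩
    ∑⁺ xs (λ x → ∑⁺ (allVecs (a + b) xs) (λ w → F (x ∷ w)))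
      ≡⟨ ∑-cong (toList xs) (λ x → ∑-allVecs-++ a b xs (λ w → F (x ∷ w))) ⟩
    ∑⁺ xs (λ x → ∑⁺ (allVecs a xs) (λ u → ∑⁺ (allVecs b xs) (λ v → F ((x ∷ u) ++ v))))
      ≡⟨ sym (∑-allVecs-suc a xs (λ u → ∑⁺ (allVecs b xs) (λ v → F (u ++ v)))) ⟩
    ∑⁺ (allVecs (suc a) xs) (λ u → ∑⁺ (allVecs b xs) (λ v → F (u ++ v)))  ∎
    where open ≡-Reasoning

  ∑-allVecs-const : ∀ n (xs : List⁺ A) c → ∑⁺ (allVecs n xs) (λ _ → c) ≡ List⁺.length xs ^ n * c
  ∑-allVecs-const zero    xs c = trans (+-identityʳ c) (sym (+-identityʳ c))
  ∑-allVecs-const (suc n) xs c =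
    trans (∑-allVecs-suc n xs (λ _ → c))
          (trans (∑-cong (toList xs) (λ _ → ∑-allVecs-const n xs c))
                 (trans (∑⁺-const xs _) (sym (*-assoc (List⁺.length xs) (List⁺.length xs ^ n) c))))

  ∑-allVecs-insertAt : ∀ n (xs : List⁺ A) (j : Fin (suc n)) (F : Vec A (suc n) → ℕ) →
    ∑⁺ (allVecs (suc n) xs) F ≡ ∑⁺ xs (λ u → ∑⁺ (allVecs n xs) (λ v → F (insertAt v j u)))
  ∑-allVecs-insertAt n       xs zero    F = ∑-allVecs-suc n xs F
  ∑-allVecs-insertAt (suc n) xs (suc j) F =
    trans (∑-allVecs-suc (suc n) xs F)
    (trans (∑-cong (toList xs) (λ x → ∑-allVecs-insertAt n xs j (λ v → F (x ∷ v))))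
    (trans (∑-comm (λ x u → ∑⁺ (allVecs n xs) (λ v → F (x ∷ insertAt v j u))) (toList xs) (toList xs))
           (∑-cong (toList xs) (λ u → sym (∑-allVecs-suc n xs (λ v → F (insertAt v (suc j) u)))))))

  module _ (_≟_ : DecidableEquality A) where
    open BoolEquality _≟_ using (_≡ᵇ_)
    open module VecEquality {n} = BoolEquality (≡-dec {n = n} _≟_) using () renaming (_≡ᵇ_ to _≡ᵛ_)

    EachOnce-allVecs : ∀ (xs : List⁺ A) → EachOnce[ _≟_ ] xs → ∀ n → EachOnce[ ≡-dec _≟_ ] (allVecs n xs)
    EachOnce-allVecs xs once zero    []       = refl
    EachOnce-allVecs xs once (suc n) (a ∷ as) = begin
      ∑⁺ (allVecs (suc n) xs) (λ v → ⟦ v ≡ᵛ (a ∷ as) ⟧)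
        ≡⟨ ∑-allVecs-suc n xs (λ v → ⟦ v ≡ᵛ (a ∷ as) ⟧) ⟩
      ∑⁺ xs (λ x → ∑⁺ (allVecs n xs) (λ v → ⟦ (x ∷ v) ≡ᵛ (a ∷ as) ⟧))
        ≡⟨ ∑-cong (toList xs) (λ x → ∑-cong (toList (allVecs n xs)) (λ v →
             cong ⟦_⟧ (⌊≡-dec⌋-∷ _≟_ x a v as))) ⟩
      ∑⁺ xs (λ x → ∑⁺ (allVecs n xs) (λ v → ⟦ (x ≡ᵇ a) ∧ v ≡ᵛ as ⟧))
        ≡⟨ ∑-cong (toList xs) (λ x → trans (∑-cong (toList (allVecs n xs)) (λ v → ⟦∧⟧ (x ≡ᵇ a) _))
                                    (∑-*ˡ ⟦ x ≡ᵇ a ⟧ _ (toList (allVecs n xs)))) ⟩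
      ∑⁺ xs (λ x → ⟦ x ≡ᵇ a ⟧ * ∑⁺ (allVecs n xs) (λ v → ⟦ v ≡ᵛ as ⟧))
        ≡⟨ ∑-cong (toList xs) (λ x → trans (cong (⟦ x ≡ᵇ a ⟧ *_) (EachOnce-allVecs xs once n as))
                                          (*-identityʳ _)) ⟩
      ∑⁺ xs (λ x → ⟦ x ≡ᵇ a ⟧)
        ≡⟨ once a ⟩
      1  ∎
      where open ≡-Reasoning

bools : List⁺ Bool
bools = false ∷ true ∷ []

allBits≡allVecs : ∀ k → allBits k ≡ allVecs k bools
allBits≡allVecs zero    = refl
allBits≡allVecs (suc k) = cong (λ vs → concatMap (λ b → List⁺.map (b ∷_) vs) bools) (allBits≡allVecs k)

EachOnce-allBits : ∀ k → EachOnce[ ≡-dec _≟B_ ] (allBits k)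
EachOnce-allBits k rewrite allBits≡allVecs k = EachOnce-allVecs _≟B_ bools once k
  where
  once : EachOnce[ _≟B_ ] bools
  once false = refl
  once true  = refl

length-allBits : ∀ k → List⁺.length (allBits k) ≡ 2 ^ k
length-allBits k = begin
  List⁺.length (allBits k)                   ≡⟨ length≡∑⁺ (allBits k) ⟩
  ∑⁺ (allBits k) (λ _ → 1)                   ≡⟨ cong (λ bs → ∑⁺ bs (λ _ → 1)) (allBits≡allVecs k) ⟩
  ∑⁺ (allVecs k bools) (λ _ → 1)             ≡⟨ trans (∑-allVecs-const k bools 1) (*-identityʳ _) ⟩
  2 ^ k                                      ∎
  where open ≡-Reasoning

∑-allBits-const : ∀ s c → ∑⁺ (allBits s) (λ _ → c) ≡ 2 ^ s * c
∑-allBits-const s c = trans (∑⁺-const (allBits s) c) (cong (_* c) (length-allBits s))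

module _ {A : Set} (_∙_ : A → A → A) (xs : List⁺ A)
         (∑-∙-invariant : ∀ a (G : A → ℕ) → ∑⁺ xs (λ x → G (x ∙ a)) ≡ ∑⁺ xs G) where

  ∑-allVecs-translate : ∀ n (c : Vec A n) (F : Vec A n → ℕ) →
    ∑⁺ (allVecs n xs) (λ v → F (zipWith _∙_ v c)) ≡ ∑⁺ (allVecs n xs) F
  ∑-allVecs-translate zero    []       F = refl
  ∑-allVecs-translate (suc n) (c₀ ∷ c) F = begin
    ∑⁺ (allVecs (suc n) xs) (λ v → F (zipWith _∙_ v (c₀ ∷ c)))
      ≡⟨ ∑-allVecs-suc n xs _ ⟩
    ∑⁺ xs (λ a → ∑⁺ (allVecs n xs) (λ v → F ((a ∙ c₀) ∷ zipWith _∙_ v c)))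
      ≡⟨ ∑-cong (toList xs) (λ a → ∑-allVecs-translate n c (λ v → F ((a ∙ c₀) ∷ v))) ⟩
    ∑⁺ xs (λ a → ∑⁺ (allVecs n xs) (λ v → F ((a ∙ c₀) ∷ v)))
      ≡⟨ ∑-∙-invariant c₀ (λ a → ∑⁺ (allVecs n xs) (λ v → F (a ∷ v))) ⟩
    ∑⁺ xs (λ a → ∑⁺ (allVecs n xs) (λ v → F (a ∷ v)))
      ≡⟨ sym (∑-allVecs-suc n xs F) ⟩
    ∑⁺ (allVecs (suc n) xs) F  ∎
    where open ≡-Reasoning

∑-allBits-⊕ : ∀ s (c : Bits s) (F : Bits s → ℕ) → ∑⁺ (allBits s) (λ w → F (w ⊕ c)) ≡ ∑⁺ (allBits s) F
∑-allBits-⊕ s c F rewrite allBits≡allVecs s = ∑-allVecs-translate _xor_ bools ∑-xor-invariant s c F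
  where
  ∑-xor-invariant : ∀ a (G : Bool → ℕ) → ∑⁺ bools (λ x → G (x xor a)) ≡ ∑⁺ bools G
  ∑-xor-invariant false G = refl
  ∑-xor-invariant true  G = trans (cong (G true +_) (+-identityʳ _))
                                  (trans (+-comm (G true) _) (cong (G false +_) (sym (+-identityʳ _))))

∑-allVecs-⊕ : ∀ n s (c : Vec (Bits s) n) (F : Vec (Bits s) n → ℕ) →
  ∑⁺ (allVecs n (allBits s)) (λ v → F (zipWith _⊕_ v c)) ≡ ∑⁺ (allVecs n (allBits s)) F
∑-allVecs-⊕ n s = ∑-allVecs-translate _⊕_ (allBits s) (∑-allBits-⊕ s) n

module _ {A : Set} where

  prodApply : ∀ {n} → Vec (A → ℕ) n → Vec A n → ℕ
  prodApply []       []      = 1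
  prodApply (g ∷ gs) (a ∷ v) = g a * prodApply gs v

  prodSum : ∀ {n} → List⁺ A → Vec (A → ℕ) n → ℕ
  prodSum xs []       = 1
  prodSum xs (g ∷ gs) = ∑⁺ xs g * prodSum xs gs

  ∑-allVecs-prodApply : ∀ n (xs : List⁺ A) (gs : Vec (A → ℕ) n) →
    ∑⁺ (allVecs n xs) (prodApply gs) ≡ prodSum xs gs
  ∑-allVecs-prodApply zero    xs []       = refl
  ∑-allVecs-prodApply (suc n) xs (g ∷ gs) =
    trans (∑-allVecs-suc n xs (prodApply (g ∷ gs)))
    (trans (∑-cong (toList xs) (λ a → trans (∑-*ˡ (g a) (prodApply gs) (toList (allVecs n xs)))
                                            (cong (g a *_) (∑-allVecs-prodApply n xs gs))))
           (∑-*ʳ (prodSum xs gs) g (toList xs)))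

  prodSum-replicate : ∀ (xs : List⁺ A) (g : A → ℕ) n → prodSum xs (replicate n g) ≡ ∑⁺ xs g ^ n
  prodSum-replicate xs g zero    = refl
  prodSum-replicate xs g (suc n) = cong (∑⁺ xs g *_) (prodSum-replicate xs g n)

prodSum-map : ∀ {A B : Set} (xs : List⁺ B) (G : A → B → ℕ) {n} (t : Vec A n) →
  prodSum xs (map G t) ≡ prodApply (replicate n (λ x → ∑⁺ xs (G x))) t
prodSum-map xs G []      = refl
prodSum-map xs G (x ∷ t) = cong (∑⁺ xs (G x) *_) (prodSum-map xs G t)

-- the number of characters, 2 ^ k, in the shape in which tables split on their first bit
∣Chr∣ : ℕ → ℕ
∣Chr∣ zero    = 1
∣Chr∣ (suc k) = ∣Chr∣ k + ∣Chr∣ k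

entriesᵇ : ∀ {A : Set} k → (Bits k → A) → Vec A (∣Chr∣ k)
entriesᵇ zero    f = f [] ∷ []
entriesᵇ (suc k) f = entriesᵇ k (λ v → f (false ∷ v)) ++ entriesᵇ k (λ v → f (true ∷ v))

entries : ∀ {m k s} → Tables m k s → Vec (Bits s) (m * ∣Chr∣ k)
entries {zero}  T = []
entries {suc m} {k} T = entriesᵇ k (T zero) ++ entries (λ j → T (suc j))

module _ {A : Set} (k : ℕ) (xs : List⁺ A) (K : Vec A (∣Chr∣ (suc k)) → ℕ) where

  -- stated for an arbitrary `merge` so that the pattern lambda inside allFunsBits
  -- can be supplied by unification, with `refl` for both hypotheses
  ∑-allFunsBits-split :
    (merge : (Bits k → A) → (Bits k → A) → Bits (suc k) → A) →
    allFunsBits (suc k) xs ≡ concatMap (λ f → List⁺.map (merge f) (allFunsBits k xs)) (allFunsBits k xs) →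
    (∀ f g → entriesᵇ (suc k) (merge f g) ≡ entriesᵇ k f ++ entriesᵇ k g) →
    ∑⁺ (allFunsBits (suc k) xs) (K ∘ entriesᵇ (suc k))
      ≡ ∑⁺ (allFunsBits k xs) (λ f → ∑⁺ (allFunsBits k xs) (λ g → K (entriesᵇ k f ++ entriesᵇ k g)))
  ∑-allFunsBits-split merge split entries-merge =
    trans (cong (λ fs → ∑⁺ fs (K ∘ entriesᵇ (suc k))) split)
    (trans (∑⁺-concatMap (λ f → List⁺.map (merge f) (allFunsBits k xs)) (K ∘ entriesᵇ (suc k)) (allFunsBits k xs))
          (∑-cong (toList (allFunsBits k xs)) (λ f →
            trans (∑⁺-map (merge f) (K ∘ entriesᵇ (suc k)) (allFunsBits k xs))
                  (∑-cong (toList (allFunsBits k xs)) (λ g → cong K (entries-merge f g))))))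

∑-allFunsBits : ∀ {A : Set} k (xs : List⁺ A) (K : Vec A (∣Chr∣ k) → ℕ) →
  ∑⁺ (allFunsBits k xs) (λ f → K (entriesᵇ k f)) ≡ ∑⁺ (allVecs (∣Chr∣ k) xs) K
∑-allFunsBits zero    xs K =
  trans (∑⁺-map (λ a _ → a) (λ f → K (entriesᵇ 0 f)) xs)
        (sym (trans (∑-allVecs-suc 0 xs K) (∑-cong (toList xs) (λ a → +-identityʳ (K (a ∷ []))))))
∑-allFunsBits (suc k) xs K = begin
  ∑⁺ (allFunsBits (suc k) xs) (λ f → K (entriesᵇ (suc k) f))
    ≡⟨ ∑-allFunsBits-split k xs K _ refl (λ _ _ → refl) ⟩
  ∑⁺ (allFunsBits k xs) (λ f → ∑⁺ (allFunsBits k xs) (λ g → K (entriesᵇ k f ++ entriesᵇ k g)))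
    ≡⟨ ∑-cong (toList (allFunsBits k xs)) (λ f → ∑-allFunsBits k xs (λ w → K (entriesᵇ k f ++ w))) ⟩
  ∑⁺ (allFunsBits k xs) (λ f → ∑⁺ (allVecs (∣Chr∣ k) xs) (λ w → K (entriesᵇ k f ++ w)))
    ≡⟨ ∑-allFunsBits k xs (λ u → ∑⁺ (allVecs (∣Chr∣ k) xs) (λ w → K (u ++ w))) ⟩
  ∑⁺ (allVecs (∣Chr∣ k) xs) (λ u → ∑⁺ (allVecs (∣Chr∣ k) xs) (λ w → K (u ++ w)))
    ≡⟨ sym (∑-allVecs-++ (∣Chr∣ k) (∣Chr∣ k) xs K) ⟩
  ∑⁺ (allVecs (∣Chr∣ (suc k)) xs) K  ∎
  where open ≡-Reasoning

module _ (m k s : ℕ) (K : Vec (Bits s) (suc m * ∣Chr∣ k) → ℕ) where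

  private
    rows : List⁺ (Chr k → Bits s)
    rows = allFunsBits k (allBits s)

  -- as for ∑-allFunsBits-split, `cons` is the pattern lambda inside allFunsFin
  ∑-allTables-split :
    (cons : (Chr k → Bits s) → Tables m k s → Tables (suc m) k s) →
    allTables (suc m) k s ≡ concatMap (λ b → List⁺.map (cons b) (allTables m k s)) rows →
    (∀ b T → entries (cons b T) ≡ entriesᵇ k b ++ entries T) →
    ∑⁺ (allTables (suc m) k s) (K ∘ entries)
      ≡ ∑⁺ rows (λ b → ∑⁺ (allTables m k s) (λ T → K (entriesᵇ k b ++ entries T)))
  ∑-allTables-split cons split entries-cons =
    trans (cong (λ Ts → ∑⁺ Ts (K ∘ entries)) split)
    (trans (∑⁺-concatMap (λ b → List⁺.map (cons b) (allTables m k s)) (K ∘ entries) rows)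
           (∑-cong (toList rows) (λ b →
             trans (∑⁺-map (cons b) (K ∘ entries) (allTables m k s))
                   (∑-cong (toList (allTables m k s)) (λ T → cong K (entries-cons b T))))))

∑-allTables : ∀ m k s (K : Vec (Bits s) (m * ∣Chr∣ k) → ℕ) →
  ∑⁺ (allTables m k s) (K ∘ entries) ≡ ∑⁺ (allVecs (m * ∣Chr∣ k) (allBits s)) K
∑-allTables zero    k s K = refl
∑-allTables (suc m) k s K = begin
  ∑⁺ (allTables (suc m) k s) (K ∘ entries)
    ≡⟨ ∑-allTables-split m k s K _ refl (λ _ _ → refl) ⟩
  ∑⁺ rows (λ b → ∑⁺ (allTables m k s) (λ T → K (entriesᵇ k b ++ entries T)))
    ≡⟨ ∑-cong (toList rows) (λ b → ∑-allTables m k s (λ w → K (entriesᵇ k b ++ w))) ⟩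
  ∑⁺ rows (λ b → ∑⁺ (allVecs (m * ∣Chr∣ k) (allBits s)) (λ w → K (entriesᵇ k b ++ w)))
    ≡⟨ ∑-allFunsBits k (allBits s) (λ u → ∑⁺ (allVecs (m * ∣Chr∣ k) (allBits s)) (λ w → K (u ++ w))) ⟩
  ∑⁺ (allVecs (∣Chr∣ k) (allBits s)) (λ u → ∑⁺ (allVecs (m * ∣Chr∣ k) (allBits s)) (λ w → K (u ++ w)))
    ≡⟨ sym (∑-allVecs-++ (∣Chr∣ k) (m * ∣Chr∣ k) (allBits s) K) ⟩
  ∑⁺ (allVecs (suc m * ∣Chr∣ k) (allBits s)) K  ∎
  where
  open ≡-Reasoning
  rows = allFunsBits k (allBits s)

length-allTables : ∀ m k s → List⁺.length (allTables m k s) ≡ (2 ^ s) ^ (m * ∣Chr∣ k)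
length-allTables m k s = begin
  List⁺.length (allTables m k s)
    ≡⟨ length≡∑⁺ (allTables m k s) ⟩
  ∑⁺ (allTables m k s) (λ _ → 1)
    ≡⟨ ∑-allTables m k s (λ _ → 1) ⟩
  ∑⁺ (allVecs (m * ∣Chr∣ k) (allBits s)) (λ _ → 1)
    ≡⟨ trans (∑-allVecs-const (m * ∣Chr∣ k) (allBits s) 1) (*-identityʳ _) ⟩
  List⁺.length (allBits s) ^ (m * ∣Chr∣ k)
    ≡⟨ cong (_^ (m * ∣Chr∣ k)) (length-allBits s) ⟩
  (2 ^ s) ^ (m * ∣Chr∣ k)  ∎
  where open ≡-Reasoning

-- Linear algebra over GF(2)

infixr 30 _·_

_·_ : ∀ {s} → Bool → Bits s → Bits s
true  · w = w
false · w = 𝟎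

lincomb : ∀ {N n} → Vec Bool n → Vec (Bits N) n → Bits N
lincomb []       []       = 𝟎
lincomb (c ∷ cs) (y ∷ ys) = c · y ⊕ lincomb cs ys

Independent : ∀ {N n} → Vec (Bits N) n → Set
Independent ys = ∀ c → lincomb c ys ≡ 𝟎 → c ≡ 𝟎

linearMap : ∀ {N n s} → Vec (Bits N) n → Vec (Bits s) N → Vec (Bits s) n
linearMap ys w = map (λ y → lincomb y w) ys

·-distribˡ-⊕ : ∀ {s} b (x y : Bits s) → b · (x ⊕ y) ≡ b · x ⊕ b · y
·-distribˡ-⊕ true  x y = refl
·-distribˡ-⊕ false x y = sym (⊕-identityʳ 𝟎)

·-assoc : ∀ {s} a b (x : Bits s) → a · b · x ≡ (a ∧ b) · x
·-assoc true  b x = refl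
·-assoc false b x = refl

·-distribʳ-xor : ∀ {s} a b (x : Bits s) → (a xor b) · x ≡ a · x ⊕ b · x
·-distribʳ-xor true  true  x = sym (⊕-self x)
·-distribʳ-xor true  false x = sym (⊕-identityʳ x)
·-distribʳ-xor false b     x = sym (⊕-identityˡ _)

·-false∷ : ∀ {N} c (y : Bits N) → c · (false ∷ y) ≡ false ∷ c · y
·-false∷ true  y = refl
·-false∷ false y = refl

lincomb-++ : ∀ {a b s} (u : Vec Bool a) (u' : Vec Bool b) (w : Vec (Bits s) a) w' →
  lincomb (u ++ u') (w ++ w') ≡ lincomb u w ⊕ lincomb u' w'
lincomb-++ []      u' []      w' = sym (⊕-identityˡ _)
lincomb-++ (b ∷ u) u' (x ∷ w) w' =
  trans (cong (b · x ⊕_) (lincomb-++ u u' w w')) (sym (⊕-assoc (b · x) _ _))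

lincomb-𝟎ˡ : ∀ {N s} (w : Vec (Bits s) N) → lincomb 𝟎 w ≡ 𝟎
lincomb-𝟎ˡ []      = refl
lincomb-𝟎ˡ (x ∷ w) = trans (cong (𝟎 ⊕_) (lincomb-𝟎ˡ w)) (⊕-identityʳ 𝟎)

lincomb-⊕ˡ : ∀ {N s} (u u' : Bits N) (w : Vec (Bits s) N) →
  lincomb (u ⊕ u') w ≡ lincomb u w ⊕ lincomb u' w
lincomb-⊕ˡ []      []       []      = sym (⊕-identityʳ 𝟎)
lincomb-⊕ˡ (a ∷ u) (b ∷ u') (x ∷ w) =
  trans (cong₂ _⊕_ (·-distribʳ-xor a b x) (lincomb-⊕ˡ u u' w)) (⊕-interchange _ _ _ _)

lincomb-·ˡ : ∀ {N s} b (u : Bits N) (w : Vec (Bits s) N) → lincomb (b · u) w ≡ b · lincomb u w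
lincomb-·ˡ true  u w = refl
lincomb-·ˡ false u w = lincomb-𝟎ˡ w

lincomb-insertAt : ∀ {N n} (c : Vec Bool n) (ys : Vec (Bits N) n) j b y →
  lincomb (insertAt c j b) (insertAt ys j y) ≡ b · y ⊕ lincomb c ys
lincomb-insertAt c        ys        zero    b y = refl
lincomb-insertAt (c ∷ cs) (y' ∷ ys) (suc j) b y = begin
  c · y' ⊕ lincomb (insertAt cs j b) (insertAt ys j y)  ≡⟨ cong (c · y' ⊕_) (lincomb-insertAt cs ys j b y) ⟩
  c · y' ⊕ (b · y ⊕ lincomb cs ys)                      ≡⟨ sym (⊕-assoc (c · y') _ _) ⟩
  (c · y' ⊕ b · y) ⊕ lincomb cs ys                      ≡⟨ cong (_⊕ lincomb cs ys) (⊕-comm (c · y') (b · y)) ⟩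
  (b · y ⊕ c · y') ⊕ lincomb cs ys                      ≡⟨ ⊕-assoc _ _ _ ⟩
  b · y ⊕ (c · y' ⊕ lincomb cs ys)                      ∎
  where open ≡-Reasoning

insertAt-≡𝟎 : ∀ {n} (c : Vec Bool n) j b → insertAt c j b ≡ 𝟎 → b ≡ false × c ≡ 𝟎
insertAt-≡𝟎 {n} c j b c⁺≡𝟎 =
  trans (sym (insertAt-lookup c j b)) (trans (cong (λ v → lookup v j) c⁺≡𝟎) (lookup-replicate j false)) ,
  trans (sym (removeAt-insertAt c j b))
        (trans (cong (λ v → removeAt v j) (trans c⁺≡𝟎 (sym (insertAt-𝟎 n j))))
               (removeAt-insertAt 𝟎 j false))
  where
  insertAt-𝟎 : ∀ n (j : Fin (suc n)) → insertAt (𝟎 {n}) j false ≡ 𝟎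
  insertAt-𝟎 n       zero    = refl
  insertAt-𝟎 (suc n) (suc j) = cong (false ∷_) (insertAt-𝟎 n j)

Independent-moveToFront : ∀ {N n} (ys : Vec (Bits N) (suc n)) j →
  Independent ys → Independent (lookup ys j ∷ removeAt ys j)
Independent-moveToFront ys j indep (c₀ ∷ c) c·ys≡𝟎 = cong₂ _∷_ (proj₁ c⁺≡𝟎) (proj₂ c⁺≡𝟎)
  where
  c⁺≡𝟎 = insertAt-≡𝟎 c j c₀ (indep _
           (trans (cong (lincomb (insertAt c j c₀)) (sym (insertAt-removeAt ys j)))
                  (trans (lincomb-insertAt c (removeAt ys j) j c₀ (lookup ys j)) c·ys≡𝟎)))

linearMap-moveToFront : ∀ {N n s} (ys : Vec (Bits N) (suc n)) j (w : Vec (Bits s) N) →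
  linearMap ys w ≡ insertAt (linearMap (removeAt ys j) w) j (lincomb (lookup ys j) w)
linearMap-moveToFront ys j w =
  trans (cong (λ rs → linearMap rs w) (sym (insertAt-removeAt ys j)))
        (map-insertAt (λ y → lincomb y w) (lookup ys j) (removeAt ys j) j)

Bits0≡𝟎 : (x : Bits 0) → x ≡ 𝟎
Bits0≡𝟎 [] = refl

zeroColumnOrPivot : ∀ {N n} (ys : Vec (Bits (suc N)) n) →
  map head ys ≡ 𝟎 ⊎ Σ (Fin n) (λ j → head (lookup ys j) ≡ true)
zeroColumnOrPivot []                 = inj₁ refl
zeroColumnOrPivot ((true ∷ y) ∷ ys)  = inj₂ (zero , refl)
zeroColumnOrPivot ((false ∷ y) ∷ ys) with zeroColumnOrPivot ys
... | inj₁ column≡𝟎    = inj₁ (cong (false ∷_) column≡𝟎)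
... | inj₂ (j , pivot) = inj₂ (suc j , pivot)

linearMap-zeroColumn : ∀ {N n s} (ys : Vec (Bits (suc N)) n) → map head ys ≡ 𝟎 →
  (w₀ : Bits s) (w' : Vec (Bits s) N) → linearMap ys (w₀ ∷ w') ≡ linearMap (map tail ys) w'
linearMap-zeroColumn []                 _   w₀ w' = refl
linearMap-zeroColumn ((false ∷ r) ∷ rs) col w₀ w' =
  cong₂ _∷_ (⊕-identityˡ _) (linearMap-zeroColumn rs (cong tail col) w₀ w')

lincomb-zeroColumn : ∀ {N n} (ys : Vec (Bits (suc N)) n) → map head ys ≡ 𝟎 → ∀ c →
  lincomb c ys ≡ false ∷ lincomb c (map tail ys)
lincomb-zeroColumn []                 _   []       = refl
lincomb-zeroColumn ((false ∷ r) ∷ rs) col (c ∷ cs) =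
  cong₂ _⊕_ (·-false∷ c r) (lincomb-zeroColumn rs (cong tail col) cs)

Independent-zeroColumn : ∀ {N n} (ys : Vec (Bits (suc N)) n) → map head ys ≡ 𝟎 →
  Independent ys → Independent (map tail ys)
Independent-zeroColumn ys column≡𝟎 indep c c·tails≡𝟎 =
  indep c (trans (lincomb-zeroColumn ys column≡𝟎 c) (cong (false ∷_) c·tails≡𝟎))

lincombHead : ∀ {N n} → Vec Bool n → Vec (Bits (suc N)) n → Bool
lincombHead []       []       = false
lincombHead (c ∷ cs) (r ∷ rs) = (c ∧ head r) xor lincombHead cs rs

lincomb-head∷tail : ∀ {N n} (c : Vec Bool n) (rs : Vec (Bits (suc N)) n) →
  lincomb c rs ≡ lincombHead c rs ∷ lincomb c (map tail rs)
lincomb-head∷tail []           []             = refl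
lincomb-head∷tail (true ∷ cs)  ((b ∷ r) ∷ rs) = cong ((b ∷ r) ⊕_) (lincomb-head∷tail cs rs)
lincomb-head∷tail (false ∷ cs) ((b ∷ r) ∷ rs) = cong (𝟎 ⊕_) (lincomb-head∷tail cs rs)

-- full-rank linear maps push the uniform distribution forward to the uniform distribution
LinearMapsEquidistribute : ℕ → ℕ → ℕ → Set
LinearMapsEquidistribute s N n =
  ∀ (ys : Vec (Bits N) n) → Independent ys → (F : Vec (Bits s) n → ℕ) →
  ∑⁺ (allVecs N (allBits s)) (F ∘ linearMap ys) * (2 ^ s) ^ n ≡ (2 ^ s) ^ N * ∑⁺ (allVecs n (allBits s)) F

module Elimination {N n : ℕ} (p : Bits N) (rest : Vec (Bits (suc N)) n) where

  eliminated : Vec (Bits N) n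
  eliminated = map (λ r → tail r ⊕ head r · p) rest

  lincomb-eliminated : ∀ {m} (c : Vec Bool m) (rs : Vec (Bits (suc N)) m) →
    lincomb c (map (λ r → tail r ⊕ head r · p) rs) ≡ lincomb c (map tail rs) ⊕ lincombHead c rs · p
  lincomb-eliminated []       []             = sym (⊕-identityʳ 𝟎)
  lincomb-eliminated (c ∷ cs) ((b ∷ r) ∷ rs) = begin
    c · (r ⊕ b · p) ⊕ lincomb cs (map (λ r → tail r ⊕ head r · p) rs)
      ≡⟨ cong₂ _⊕_ (trans (·-distribˡ-⊕ c r (b · p)) (cong (c · r ⊕_) (·-assoc c b p)))
                   (lincomb-eliminated cs rs) ⟩
    (c · r ⊕ (c ∧ b) · p) ⊕ (lincomb cs (map tail rs) ⊕ lincombHead cs rs · p)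
      ≡⟨ ⊕-interchange (c · r) ((c ∧ b) · p) _ _ ⟩
    (c · r ⊕ lincomb cs (map tail rs)) ⊕ ((c ∧ b) · p ⊕ lincombHead cs rs · p)
      ≡⟨ cong (_ ⊕_) (sym (·-distribʳ-xor (c ∧ b) (lincombHead cs rs) p)) ⟩
    (c · r ⊕ lincomb cs (map tail rs)) ⊕ ((c ∧ b) xor lincombHead cs rs) · p  ∎
    where open ≡-Reasoning

  Independent-eliminated : Independent ((true ∷ p) ∷ rest) → Independent eliminated
  Independent-eliminated indep c c·elim≡𝟎 =
    cong tail (indep (lincombHead c rest ∷ c)
                     (combine (lincombHead c rest) (lincomb-head∷tail c rest)
                              (trans (sym (lincomb-eliminated c rest)) c·elim≡𝟎)))
    where
    combine : ∀ h {t} → lincomb c rest ≡ h ∷ t → t ⊕ h · p ≡ 𝟎 → h · (true ∷ p) ⊕ lincomb c rest ≡ 𝟎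
    combine true  {t} c·rest≡ t⊕p≡𝟎 =
      trans (cong ((true ∷ p) ⊕_) c·rest≡) (cong (false ∷_) (trans (⊕-comm p t) t⊕p≡𝟎))
    combine false {t} c·rest≡ t⊕𝟎≡𝟎 =
      trans (cong (𝟎 ⊕_) c·rest≡)
            (cong (false ∷_) (trans (⊕-identityˡ t) (trans (sym (⊕-identityʳ t)) t⊕𝟎≡𝟎)))

  firstColumn : ∀ {s} → Bits s → Vec (Bits s) n
  firstColumn u = map (λ r → head r · u) rest

  -- in the coordinate u = w₀ ⊕ lincomb p w' the pivot row becomes u and the others lose their first column
  linearMap-pivot : ∀ {s} (w₀ : Bits s) w' →
    linearMap ((true ∷ p) ∷ rest) (w₀ ∷ w')
      ≡ (w₀ ⊕ lincomb p w') ∷ zipWith _⊕_ (linearMap eliminated w') (firstColumn (w₀ ⊕ lincomb p w'))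
  linearMap-pivot w₀ w' = cong ((w₀ ⊕ lincomb p w') ∷_) (go rest)
    where
    u = w₀ ⊕ lincomb p w'
    go : ∀ {m} (rs : Vec (Bits (suc N)) m) →
      linearMap rs (w₀ ∷ w')
        ≡ zipWith _⊕_ (linearMap (map (λ r → tail r ⊕ head r · p) rs) w') (map (λ r → head r · u) rs)
    go []             = refl
    go ((b ∷ r) ∷ rs) = cong₂ _∷_ (sym row) (go rs)
      where
      X = lincomb r w'
      Y = b · lincomb p w'
      row : lincomb (r ⊕ b · p) w' ⊕ b · u ≡ b · w₀ ⊕ lincomb r w'
      row = begin
        lincomb (r ⊕ b · p) w' ⊕ b · u
          ≡⟨ cong₂ _⊕_ (trans (lincomb-⊕ˡ r (b · p) w') (cong (X ⊕_) (lincomb-·ˡ b p w')))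
                       (·-distribˡ-⊕ b w₀ (lincomb p w')) ⟩
        (X ⊕ Y) ⊕ (b · w₀ ⊕ Y)   ≡⟨ ⊕-interchange X Y (b · w₀) Y ⟩
        (X ⊕ b · w₀) ⊕ (Y ⊕ Y)   ≡⟨ cong ((X ⊕ b · w₀) ⊕_) (⊕-self Y) ⟩
        (X ⊕ b · w₀) ⊕ 𝟎         ≡⟨ ⊕-identityʳ _ ⟩
        X ⊕ b · w₀               ≡⟨ ⊕-comm X (b · w₀) ⟩
        b · w₀ ⊕ X               ∎
        where open ≡-Reasoning

  -- summing over w₀ first, the change of variable u = w₀ ⊕ lincomb p w' is a translation
  ∑-linearMap-pivot-substitute : ∀ {s} (F : Vec (Bits s) (suc n) → ℕ) →
    ∑⁺ (allVecs (suc N) (allBits s)) (F ∘ linearMap ((true ∷ p) ∷ rest))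
      ≡ ∑⁺ (allBits s) (λ u → ∑⁺ (allVecs N (allBits s)) (λ w' →
          F (u ∷ zipWith _⊕_ (linearMap eliminated w') (firstColumn u))))
  ∑-linearMap-pivot-substitute {s} F = begin
    ∑⁺ (allVecs (suc N) B) (F ∘ linearMap ((true ∷ p) ∷ rest))
      ≡⟨ ∑-allVecs-suc N B (F ∘ linearMap ((true ∷ p) ∷ rest)) ⟩
    ∑⁺ B (λ w₀ → ∑⁺ (allVecs N B) (λ w' → F (linearMap ((true ∷ p) ∷ rest) (w₀ ∷ w'))))
      ≡⟨ ∑-cong (toList B) (λ w₀ → ∑-cong (toList (allVecs N B)) (λ w' → cong F (linearMap-pivot w₀ w'))) ⟩
    ∑⁺ B (λ w₀ → ∑⁺ (allVecs N B) (λ w' → G (w₀ ⊕ lincomb p w') w'))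
      ≡⟨ ∑-comm (λ w₀ w' → G (w₀ ⊕ lincomb p w') w') (toList B) (toList (allVecs N B)) ⟩
    ∑⁺ (allVecs N B) (λ w' → ∑⁺ B (λ w₀ → G (w₀ ⊕ lincomb p w') w'))
      ≡⟨ ∑-cong (toList (allVecs N B)) (λ w' → ∑-allBits-⊕ s (lincomb p w') (λ u → G u w')) ⟩
    ∑⁺ (allVecs N B) (λ w' → ∑⁺ B (λ u → G u w'))
      ≡⟨ ∑-comm (λ w' u → G u w') (toList (allVecs N B)) (toList B) ⟩
    ∑⁺ B (λ u → ∑⁺ (allVecs N B) (G u))  ∎
    where
    open ≡-Reasoning
    B = allBits s
    G : Bits s → Vec (Bits s) N → ℕ
    G u w' = F (u ∷ zipWith _⊕_ (linearMap eliminated w') (firstColumn u))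

  ∑-linearMap-pivot : ∀ {s} → LinearMapsEquidistribute s N n → Independent ((true ∷ p) ∷ rest) →
    (F : Vec (Bits s) (suc n) → ℕ) →
    ∑⁺ (allVecs (suc N) (allBits s)) (F ∘ linearMap ((true ∷ p) ∷ rest)) * (2 ^ s) ^ suc n
      ≡ (2 ^ s) ^ suc N * ∑⁺ (allVecs (suc n) (allBits s)) F
  ∑-linearMap-pivot {s} equidistribute indep F = begin
    ∑⁺ (allVecs (suc N) B) (F ∘ linearMap ((true ∷ p) ∷ rest)) * (q * q ^ n)
      ≡⟨ cong (_* (q * q ^ n)) (∑-linearMap-pivot-substitute F) ⟩
    ∑⁺ B (λ u → ∑⁺ (allVecs N B) (Fᵤ u ∘ linearMap eliminated)) * (q * q ^ n)
      ≡⟨ trans (*-CS.x∙yz≈y∙xz (∑⁺ B (λ u → ∑⁺ (allVecs N B) (Fᵤ u ∘ linearMap eliminated))) q (q ^ n))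
               (cong (q *_) (sym (∑-*ʳ (q ^ n) (λ u → ∑⁺ (allVecs N B) (Fᵤ u ∘ linearMap eliminated))
                                        (toList B)))) ⟩
    q * ∑⁺ B (λ u → ∑⁺ (allVecs N B) (Fᵤ u ∘ linearMap eliminated) * q ^ n)
      ≡⟨ cong (q *_) (∑-cong (toList B) (λ u → equidistribute eliminated (Independent-eliminated indep) (Fᵤ u))) ⟩
    q * ∑⁺ B (λ u → q ^ N * ∑⁺ (allVecs n B) (Fᵤ u))
      ≡⟨ cong (q *_) (∑-*ˡ (q ^ N) (λ u → ∑⁺ (allVecs n B) (Fᵤ u)) (toList B)) ⟩
    q * (q ^ N * ∑⁺ B (λ u → ∑⁺ (allVecs n B) (Fᵤ u)))
      ≡⟨ cong (λ z → q * (q ^ N * z))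
              (∑-cong (toList B) (λ u → ∑-allVecs-⊕ n s (firstColumn u) (λ v → F (u ∷ v)))) ⟩
    q * (q ^ N * ∑⁺ B (λ u → ∑⁺ (allVecs n B) (λ v → F (u ∷ v))))
      ≡⟨ trans (sym (*-assoc q (q ^ N) _)) (cong (q ^ suc N *_) (sym (∑-allVecs-suc n B F))) ⟩
    q ^ suc N * ∑⁺ (allVecs (suc n) B) F  ∎
    where
    open ≡-Reasoning
    q = 2 ^ s
    B = allBits s
    Fᵤ : Bits s → Vec (Bits s) n → ℕ
    Fᵤ u v = F (u ∷ zipWith _⊕_ v (firstColumn u))

linearMap-equidistributed : ∀ s N n → LinearMapsEquidistribute s N n
linearMap-equidistributed s zero    zero    []       indep F = *-comm _ 1
linearMap-equidistributed s zero    (suc n) (y ∷ ys) indep F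
  with () ← cong head (indep (true ∷ 𝟎) (Bits0≡𝟎 _))
linearMap-equidistributed s (suc N) n       ys       indep F with zeroColumnOrPivot ys
... | inj₁ column≡𝟎 = begin
  ∑⁺ (allVecs (suc N) B) (F ∘ linearMap ys) * q ^ n
    ≡⟨ cong (_* q ^ n) (trans (∑-allVecs-suc N B (F ∘ linearMap ys))
         (∑-cong (toList B) (λ w₀ → ∑-cong (toList (allVecs N B)) (λ w' →
           cong F (linearMap-zeroColumn ys column≡𝟎 w₀ w'))))) ⟩
  ∑⁺ B (λ _ → ∑⁺ (allVecs N B) (F ∘ linearMap (map tail ys))) * q ^ n
    ≡⟨ cong (_* q ^ n) (∑-allBits-const s _) ⟩
  q * ∑⁺ (allVecs N B) (F ∘ linearMap (map tail ys)) * q ^ n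
    ≡⟨ *-assoc q _ (q ^ n) ⟩
  q * (∑⁺ (allVecs N B) (F ∘ linearMap (map tail ys)) * q ^ n)
    ≡⟨ cong (q *_) (linearMap-equidistributed s N n (map tail ys) (Independent-zeroColumn ys column≡𝟎 indep) F) ⟩
  q * (q ^ N * ∑⁺ (allVecs n B) F)
    ≡⟨ sym (*-assoc q (q ^ N) _) ⟩
  q ^ suc N * ∑⁺ (allVecs n B) F  ∎
  where
  open ≡-Reasoning
  q = 2 ^ s
  B = allBits s
linearMap-equidistributed s (suc N) (suc n) ys indep F | inj₂ (j , pivot) = begin
  ∑⁺ (allVecs (suc N) B) (F ∘ linearMap ys) * q ^ suc n
    ≡⟨ cong (_* q ^ suc n) (∑-cong (toList (allVecs (suc N) B)) (λ w → cong F (linearMap-moveToFront ys j w))) ⟩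
  ∑⁺ (allVecs (suc N) B) (F' ∘ linearMap (lookup ys j ∷ removeAt ys j)) * q ^ suc n
    ≡⟨ pivotFirst (lookup ys j) pivot (Independent-moveToFront ys j indep) ⟩
  q ^ suc N * ∑⁺ (allVecs (suc n) B) F'
    ≡⟨ cong (q ^ suc N *_) (trans (∑-allVecs-suc n B F') (sym (∑-allVecs-insertAt n B j F))) ⟩
  q ^ suc N * ∑⁺ (allVecs (suc n) B) F  ∎
  where
  open ≡-Reasoning
  q = 2 ^ s
  B = allBits s
  F' : Vec (Bits s) (suc n) → ℕ
  F' v = F (insertAt (tail v) j (head v))
  pivotFirst : ∀ y → head y ≡ true → Independent (y ∷ removeAt ys j) →
    ∑⁺ (allVecs (suc N) B) (F' ∘ linearMap (y ∷ removeAt ys j)) * q ^ suc n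
      ≡ q ^ suc N * ∑⁺ (allVecs (suc n) B) F'
  pivotFirst (true ∷ p) refl indep′ =
    Elimination.∑-linearMap-pivot p (removeAt ys j) (linearMap-equidistributed s N n) indep′ F'

-- Simple tabulation as a linear map

oneHot : ∀ k → Bits k → Vec Bool (∣Chr∣ k)
oneHot zero    []          = true ∷ []
oneHot (suc k) (false ∷ a) = oneHot k a ++ 𝟎
oneHot (suc k) (true ∷ a)  = 𝟎 ++ oneHot k a

-- the indicator vector of the position characters of a key
positionChars : ∀ {m k} → Vec (Bits k) m → Vec Bool (m * ∣Chr∣ k)
positionChars []          = []
positionChars {k = k} (a ∷ y) = oneHot k a ++ positionChars y

lincomb-oneHot : ∀ {s} k (a : Bits k) (f : Bits k → Bits s) → lincomb (oneHot k a) (entriesᵇ k f) ≡ f a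
lincomb-oneHot zero    []          f = ⊕-identityʳ (f [])
lincomb-oneHot (suc k) (false ∷ a) f =
  trans (lincomb-++ (oneHot k a) 𝟎 (entriesᵇ k _) _)
        (trans (cong₂ _⊕_ (lincomb-oneHot k a _) (lincomb-𝟎ˡ (entriesᵇ k (λ v → f (true ∷ v)))))
               (⊕-identityʳ _))
lincomb-oneHot (suc k) (true ∷ a)  f =
  trans (lincomb-++ 𝟎 (oneHot k a) (entriesᵇ k _) _)
        (trans (cong₂ _⊕_ (lincomb-𝟎ˡ (entriesᵇ k (λ v → f (false ∷ v)))) (lincomb-oneHot k a _))
               (⊕-identityˡ _))

simpleTab≡lincomb : ∀ {m k s} (T : Tables m k s) (y : Vec (Bits k) m) →
  simpleTab T y ≡ lincomb (positionChars y) (entries T)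
simpleTab≡lincomb {zero}          T []      = refl
simpleTab≡lincomb {suc m} {k} {s} T (a ∷ y) = sym (begin
  lincomb (oneHot k a ++ positionChars y) (entriesᵇ k (T zero) ++ entries (λ j → T (suc j)))
    ≡⟨ lincomb-++ (oneHot k a) (positionChars y) (entriesᵇ k (T zero)) _ ⟩
  lincomb (oneHot k a) (entriesᵇ k (T zero)) ⊕ lincomb (positionChars y) (entries (λ j → T (suc j)))
    ≡⟨ cong₂ _⊕_ (lincomb-oneHot k a (T zero)) (sym (simpleTab≡lincomb (λ j → T (suc j)) y)) ⟩
  T zero a ⊕ simpleTab (λ j → T (suc j)) y  ∎)
  where open ≡-Reasoning

simpleTab-equidistributed : ∀ m k s n (ys : Vec (Vec (Bits k) m) n) →
  Independent (map positionChars ys) → (F : Vec (Bits s) n → ℕ) →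
  ∑⁺ (allTables m k s) (λ T → F (map (simpleTab T) ys)) * (2 ^ s) ^ n
    ≡ List⁺.length (allTables m k s) * ∑⁺ (allVecs n (allBits s)) F
simpleTab-equidistributed m k s n ys indep F = begin
  ∑⁺ (allTables m k s) (λ T → F (map (simpleTab T) ys)) * (2 ^ s) ^ n
    ≡⟨ cong (_* (2 ^ s) ^ n) (∑-cong (toList (allTables m k s)) (λ T → cong F (map-simpleTab T ys))) ⟩
  ∑⁺ (allTables m k s) (F ∘ linearMap (map positionChars ys) ∘ entries) * (2 ^ s) ^ n
    ≡⟨ cong (_* (2 ^ s) ^ n) (∑-allTables m k s (F ∘ linearMap (map positionChars ys))) ⟩
  ∑⁺ (allVecs (m * ∣Chr∣ k) (allBits s)) (F ∘ linearMap (map positionChars ys)) * (2 ^ s) ^ n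
    ≡⟨ linearMap-equidistributed s (m * ∣Chr∣ k) n (map positionChars ys) indep F ⟩
  (2 ^ s) ^ (m * ∣Chr∣ k) * ∑⁺ (allVecs n (allBits s)) F
    ≡⟨ cong (_* ∑⁺ (allVecs n (allBits s)) F) (sym (length-allTables m k s)) ⟩
  List⁺.length (allTables m k s) * ∑⁺ (allVecs n (allBits s)) F  ∎
  where
  open ≡-Reasoning
  map-simpleTab : ∀ {n′} T (zs : Vec (Vec (Bits k) m) n′) →
    map (simpleTab T) zs ≡ linearMap (map positionChars zs) (entries T)
  map-simpleTab T []       = refl
  map-simpleTab T (z ∷ zs) = cong₂ _∷_ (simpleTab≡lincomb T z) (map-simpleTab T zs)

-- Linear independence of keys

⨁ : ∀ {N} → List (Bits N) → Bits N
⨁ []       = 𝟎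
⨁ (x ∷ xs) = x ⊕ ⨁ xs

select : ∀ {A : Set} {n} → Vec Bool n → Vec A n → List A
select []          []       = []
select (true ∷ c)  (y ∷ ys) = y ∷ select c ys
select (false ∷ c) (y ∷ ys) = select c ys

select-map : ∀ {A B : Set} {n} (f : A → B) (c : Vec Bool n) (ys : Vec A n) →
  select c (map f ys) ≡ List.map f (select c ys)
select-map f []          []       = refl
select-map f (true ∷ c)  (y ∷ ys) = cong (f y ∷_) (select-map f c ys)
select-map f (false ∷ c) (y ∷ ys) = select-map f c ys

all-select : ∀ {A : Set} {n} (p : A → Bool) (c : Vec Bool n) (t : Vec A n) →
  all p (Vec.toList t) ≡ true → all p (select c t) ≡ true
all-select p []          []      all≡true = refl
all-select p (true ∷ c)  (x ∷ t) all≡true with p x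
... | true = all-select p c t all≡true
all-select p (false ∷ c) (x ∷ t) all≡true with p x
... | true = all-select p c t all≡true

lincomb-map≡⨁-select : ∀ {A : Set} {N n} (f : A → Bits N) (c : Vec Bool n) (ys : Vec A n) →
  lincomb c (map f ys) ≡ ⨁ (List.map f (select c ys))
lincomb-map≡⨁-select f []          []       = refl
lincomb-map≡⨁-select f (true ∷ c)  (y ∷ ys) = cong (f y ⊕_) (lincomb-map≡⨁-select f c ys)
lincomb-map≡⨁-select f (false ∷ c) (y ∷ ys) = trans (⊕-identityˡ _) (lincomb-map≡⨁-select f c ys)

withHead : ∀ {k} → Bool → List (Bits (suc k)) → List (Bits k)
withHead b []             = []
withHead b ((c ∷ h) ∷ hs) = if ⌊ c ≟B b ⌋ then h ∷ withHead b hs else withHead b hs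

count-withHead : ∀ {k} b (a : Bits k) hs →
  count (λ h → h == (b ∷ a)) hs ≡ count (λ h → h == a) (withHead b hs)
count-withHead b a []             = refl
count-withHead b a ((c ∷ h) ∷ hs) rewrite ⌊≡-dec⌋-∷ _≟B_ c b h a with c ≟B b
... | yes refl with h == a
...   | true  = cong suc (count-withHead b a hs)
...   | false = count-withHead b a hs
count-withHead b a ((c ∷ h) ∷ hs) | no _ = count-withHead b a hs

-- entry a is the parity of the number of occurrences of a in hs
parities : ∀ k → List (Bits k) → Vec Bool (∣Chr∣ k)
parities k hs = ⨁ (List.map (oneHot k) hs)

parities-split : ∀ k (hs : List (Bits (suc k))) →
  parities (suc k) hs ≡ parities k (withHead false hs) ++ parities k (withHead true hs)
parities-split k []                 = 𝟎-++ (∣Chr∣ k) (∣Chr∣ k)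
parities-split k ((false ∷ h) ∷ hs) =
  trans (cong (oneHot (suc k) (false ∷ h) ⊕_) (parities-split k hs))
        (trans (⊕-++ (oneHot k h) (parities k (withHead false hs)) 𝟎 (parities k (withHead true hs)))
               (cong (oneHot k h ⊕ parities k (withHead false hs) ++_) (⊕-identityˡ _)))
parities-split k ((true ∷ h) ∷ hs)  =
  trans (cong (oneHot (suc k) (true ∷ h) ⊕_) (parities-split k hs))
        (trans (⊕-++ 𝟎 (parities k (withHead false hs)) (oneHot k h) (parities k (withHead true hs)))
               (cong (_++ (oneHot k h ⊕ parities k (withHead true hs))) (⊕-identityˡ _)))

parities≡𝟎⇒even : ∀ k (hs : List (Bits k)) → parities k hs ≡ 𝟎 →
  ∀ a → evenᵇ (count (λ h → h == a) hs) ≡ true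
parities≡𝟎⇒even zero    hs parities≡𝟎 [] =
  trans (cong evenᵇ (count-all hs)) (not-false (cong head (trans (sym (parities0 hs)) parities≡𝟎)))
  where
  evenᵇ-suc : ∀ n → evenᵇ (suc n) ≡ not (evenᵇ n)
  evenᵇ-suc zero          = refl
  evenᵇ-suc (suc zero)    = refl
  evenᵇ-suc (suc (suc n)) = evenᵇ-suc n
  parities0 : (hs : List (Bits 0)) → parities 0 hs ≡ not (evenᵇ (List.length hs)) ∷ []
  parities0 []        = refl
  parities0 ([] ∷ hs) =
    trans (cong ((true ∷ []) ⊕_) (parities0 hs)) (cong (λ e → not e ∷ []) (sym (evenᵇ-suc (List.length hs))))
  count-all : (hs : List (Bits 0)) → count (λ h → h == []) hs ≡ List.length hs
  count-all []        = refl
  count-all ([] ∷ hs) = cong suc (count-all hs)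
  not-false : ∀ {b} → not b ≡ false → b ≡ true
  not-false {true} _ = refl
parities≡𝟎⇒even (suc k) hs parities≡𝟎 (b ∷ a) =
  trans (cong evenᵇ (count-withHead b a hs))
        (parities≡𝟎⇒even k (withHead b hs) (halves b) a)
  where
  halves′ = ++-≡𝟎 _ _ (trans (sym (parities-split k hs)) parities≡𝟎)
  halves : ∀ b → parities k (withHead b hs) ≡ 𝟎
  halves false = proj₁ halves′
  halves true  = proj₂ halves′

⨁-positionChars-split : ∀ {k m} (zs : List (Vec (Bits k) (suc m))) →
  ⨁ (List.map positionChars zs) ≡ parities k (List.map head zs) ++ ⨁ (List.map positionChars (List.map tail zs))
⨁-positionChars-split {k} {m} []       = 𝟎-++ (∣Chr∣ k) (m * ∣Chr∣ k)
⨁-positionChars-split {k}     ((a ∷ y) ∷ zs) =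
  trans (cong (positionChars (a ∷ y) ⊕_) (⨁-positionChars-split zs)) (⊕-++ (oneHot k a) _ (positionChars y) _)

⨁-positionChars≡𝟎 : ∀ {k m} (zs : List (Vec (Bits k) (suc m))) → ⨁ (List.map positionChars zs) ≡ 𝟎 →
  parities k (List.map head zs) ≡ 𝟎 × ⨁ (List.map positionChars (List.map tail zs)) ≡ 𝟎
⨁-positionChars≡𝟎 zs ⨁≡𝟎 = ++-≡𝟎 _ _ (trans (sym (⨁-positionChars-split zs)) ⨁≡𝟎)

EvenChars : ∀ {k m} → List (Vec (Bits k) m) → Set
EvenChars zs = ∀ j a → evenᵇ (count (λ y → lookup y j == a) zs) ≡ true

⨁-positionChars≡𝟎⇒EvenChars : ∀ {k} m (zs : List (Vec (Bits k) m)) → ⨁ (List.map positionChars zs) ≡ 𝟎 →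
  EvenChars zs
⨁-positionChars≡𝟎⇒EvenChars {k} (suc m) zs ⨁≡𝟎 zero    a =
  trans (cong evenᵇ (trans (count-cong zs (λ { (_ ∷ _) → refl })) (sym (count-map (_== a) head zs))))
        (parities≡𝟎⇒even k (List.map head zs) (proj₁ (⨁-positionChars≡𝟎 zs ⨁≡𝟎)) a)
⨁-positionChars≡𝟎⇒EvenChars {k} (suc m) zs ⨁≡𝟎 (suc j) a =
  trans (cong evenᵇ (trans (count-cong zs (λ { (_ ∷ _) → refl }))
                           (sym (count-map (λ y → lookup y j == a) tail zs))))
        (⨁-positionChars≡𝟎⇒EvenChars m (List.map tail zs) (proj₂ (⨁-positionChars≡𝟎 zs ⨁≡𝟎)) j a)

EvenChars-prefixes : ∀ {A : Set} {k m} (f : A → Vec (Bits k) m) (g : A → Bits k) xs →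
  EvenChars (List.map (λ x → f x ∷ʳ g x) xs) → EvenChars (List.map f xs)
EvenChars-prefixes {k = k} f g xs even j a = begin
  evenᵇ (count (λ y → lookup y j == a) (List.map f xs))
    ≡⟨ cong evenᵇ (count-map _ f xs) ⟩
  evenᵇ (count (λ x → lookup (f x) j == a) xs)
    ≡⟨ cong evenᵇ (count-cong xs (λ x → cong (_== a) (sym (lookup-∷ʳ (f x) (g x) j)))) ⟩
  evenᵇ (count (λ x → lookup (f x ∷ʳ g x) (inject₁ j) == a) xs)
    ≡⟨ cong evenᵇ (sym (count-map _ (λ x → f x ∷ʳ g x) xs)) ⟩
  evenᵇ (count (λ y → lookup y (inject₁ j) == a) (List.map (λ x → f x ∷ʳ g x) xs))
    ≡⟨ even (inject₁ j) a ⟩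
  true  ∎
  where
  open ≡-Reasoning
  lookup-∷ʳ : ∀ {m} (p : Vec (Bits k) m) b (j : Fin m) → lookup (p ∷ʳ b) (inject₁ j) ≡ lookup p j
  lookup-∷ʳ (x ∷ p) b zero    = refl
  lookup-∷ʳ (x ∷ p) b (suc j) = lookup-∷ʳ p b j

allEven-intro : ∀ {k m} (zs : List (Vec (Bits k) m)) → EvenChars zs → allEven zs ≡ true
allEven-intro {k} {m} zs even =
  all-intro _ (List.allFin m) (λ j → all-intro _ (toList (allBits k)) (even j))

any-subfamilies-select : ∀ {A : Set} {n} (P : List A → Bool) (c : Vec Bool n) (ys : Vec A n) →
  P (select c ys) ≡ true → any P (subfamilies (Vec.toList ys)) ≡ true
any-subfamilies-select P [] [] P≡true rewrite P≡true = refl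
any-subfamilies-select P (true ∷ c) (y ∷ ys) P≡true =
  any-++⁺ʳ P (subfamilies (Vec.toList ys)) _
    (any-map⁺ P (y ∷_) (subfamilies (Vec.toList ys)) (any-subfamilies-select (λ zs → P (y ∷ zs)) c ys P≡true))
any-subfamilies-select P (false ∷ c) (y ∷ ys) P≡true =
  any-++⁺ˡ P (subfamilies (Vec.toList ys)) _ (any-subfamilies-select P c ys P≡true)

null-select : ∀ {A : Set} {n} (c : Vec Bool n) (ys : Vec A n) → c ≢ 𝟎 → null (select c ys) ≡ false
null-select []          []       c≢𝟎 = ⊥-elim (c≢𝟎 refl)
null-select (true ∷ c)  (y ∷ ys) c≢𝟎 = refl
null-select (false ∷ c) (y ∷ ys) c≢𝟎 = null-select c ys (c≢𝟎 ∘ cong (false ∷_))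

nonemptyEven : ∀ {k m} → List (Vec (Bits k) m) → Bool
nonemptyEven zs = not (null zs) ∧ allEven zs

allEven-select⇒¬linIndep : ∀ {k m n} (ys : Vec (Vec (Bits k) m) n) c → c ≢ 𝟎 →
  allEven (select c ys) ≡ true → linIndep (Vec.toList ys) ≡ false
allEven-select⇒¬linIndep ys c c≢𝟎 allEven≡true =
  cong not (any-subfamilies-select nonemptyEven c ys evenSubfamily)
  where
  evenSubfamily : nonemptyEven (select c ys) ≡ true
  evenSubfamily rewrite null-select c ys c≢𝟎 | allEven≡true = refl

any-subfamilies⇒select : ∀ {A : Set} {n} (P : List A → Bool) (v : Vec A n) →
  any P (subfamilies (Vec.toList v)) ≡ true → Σ (Vec Bool n) (λ c → P (select c v) ≡ true)
any-subfamilies⇒select P []      any≡true = [] , trans (sym (∨-identityʳ _)) any≡true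
any-subfamilies⇒select P (y ∷ v) any≡true with any-++⁻ P (subfamilies (Vec.toList v)) _ any≡true
... | inj₁ without-y =
  let (c , Pc) = any-subfamilies⇒select P v without-y in false ∷ c , Pc
... | inj₂ with-y    =
  let (c , Pc) = any-subfamilies⇒select (λ zs → P (y ∷ zs)) v
                   (any-map⁻ P (y ∷_) (subfamilies (Vec.toList v)) with-y)
  in true ∷ c , Pc

any-subfamilies-filterᵇ : ∀ {A B : Set} (P : List B → Bool) (f : A → B) (m : A → Bool) xs →
  P (List.map f (filterᵇ m xs)) ≡ true → any P (subfamilies (List.map f xs)) ≡ true
any-subfamilies-filterᵇ P f m []       P≡true rewrite P≡true = refl
any-subfamilies-filterᵇ P f m (x ∷ xs) P≡true with m x
... | true  = any-++⁺ʳ P (subfamilies (List.map f xs)) _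
                (any-map⁺ P (f x ∷_) (subfamilies (List.map f xs))
                  (any-subfamilies-filterᵇ (λ zs → P (f x ∷ zs)) f m xs P≡true))
... | false = any-++⁺ˡ P (subfamilies (List.map f xs)) _ (any-subfamilies-filterᵇ P f m xs P≡true)

nonemptyEven-count : ∀ {k m} (ys ys' : List (Vec (Bits k) m)) →
  (∀ p → count p ys ≡ count p ys') → nonemptyEven ys ≡ nonemptyEven ys'
nonemptyEven-count {k} {m} ys ys' same-counts = cong₂ (λ a b → not a ∧ b)
  (null-cong ys ys' (trans (sym (count-true ys)) (trans (same-counts (λ _ → true)) (count-true ys'))))
  (all-cong (List.allFin m) (λ j → all-cong (toList (allBits k)) (λ a →
    cong evenᵇ (same-counts (λ y → lookup y j == a)))))

module _ {k m m′ n : ℕ} (ys : Vec (Vec (Bits k) m) n) (keys : Vec (Vec (Bits k) m′) n)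
         (EvenChars-keys⇒ys : ∀ c → EvenChars (select c keys) → EvenChars (select c ys)) where

  linIndep⇒Independent′ : linIndep (Vec.toList ys) ≡ true → Independent (map positionChars keys)
  linIndep⇒Independent′ indep c c·keys≡𝟎 with ≡-dec _≟B_ c 𝟎
  ... | yes c≡𝟎 = c≡𝟎
  ... | no  c≢𝟎 = ⊥-elim (false≢true (trans (sym (allEven-select⇒¬linIndep ys c c≢𝟎 evenSubfamily)) indep))
    where
    evenSubfamily : allEven (select c ys) ≡ true
    evenSubfamily = allEven-intro (select c ys) (EvenChars-keys⇒ys c
      (⨁-positionChars≡𝟎⇒EvenChars m′ (select c keys)
        (trans (sym (lincomb-map≡⨁-select positionChars c keys)) c·keys≡𝟎)))

linIndep⇒Independent : ∀ {k m n} (ys : Vec (Vec (Bits k) m) n) →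
  linIndep (Vec.toList ys) ≡ true → Independent (map positionChars ys)
linIndep⇒Independent ys = linIndep⇒Independent′ ys ys (λ _ even → even)

-- 𝒥 only asks for independence of the prefixes x̃₁⋯x̃_{c+d-1}
linIndep-prefixes⇒Independent : ∀ {A : Set} {k m n} (t : Vec A n) (f : A → Vec (Bits k) m) (g : A → Bits k) →
  linIndep (Vec.toList (map f t)) ≡ true → Independent (map positionChars (map (λ x → f x ∷ʳ g x) t))
linIndep-prefixes⇒Independent t f g =
  linIndep⇒Independent′ (map f t) (map (λ x → f x ∷ʳ g x) t) λ c even →
    subst EvenChars (sym (select-map f c t))
      (EvenChars-prefixes f g (select c t) (subst EvenChars (select-map (λ x → f x ∷ʳ g x) c t) even))

-- Collisions of the last derived character

allEqualTo : ∀ {k n} → Bits k → Vec (Bits k) n → Bool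
allEqualTo a []      = true
allEqualTo a (b ∷ v) = (b == a) ∧ allEqualTo a v

allEqual : ∀ {k n} → Vec (Bits k) n → Bool
allEqual []      = true
allEqual (a ∷ v) = allEqualTo a v

∑-allEqual : ∀ k n → ∑⁺ (allVecs (suc n) (allBits k)) (λ v → ⟦ allEqual v ⟧) ≡ 2 ^ k
∑-allEqual k n = begin
  ∑⁺ (allVecs (suc n) B) (λ v → ⟦ allEqual v ⟧)
    ≡⟨ ∑-allVecs-suc n B (λ v → ⟦ allEqual v ⟧) ⟩
  ∑⁺ B (λ a → ∑⁺ (allVecs n B) (λ v → ⟦ allEqualTo a v ⟧))
    ≡⟨ ∑-cong (toList B) (λ a → ∑-cong (toList (allVecs n B)) (⟦allEqualTo⟧ a)) ⟩
  ∑⁺ B (λ a → ∑⁺ (allVecs n B) (prodApply (replicate n (λ b → ⟦ b == a ⟧))))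
    ≡⟨ ∑-cong (toList B) (λ a → ∑-allVecs-prodApply n B (replicate n (λ b → ⟦ b == a ⟧))) ⟩
  ∑⁺ B (λ a → prodSum B (replicate n (λ b → ⟦ b == a ⟧)))
    ≡⟨ ∑-cong (toList B) (λ a → trans (prodSum-replicate B _ n)
                                      (trans (cong (_^ n) (EachOnce-allBits k a)) (^-zeroˡ n))) ⟩
  ∑⁺ B (λ _ → 1)
    ≡⟨ trans (∑-allBits-const k 1) (*-identityʳ _) ⟩
  2 ^ k  ∎
  where
  open ≡-Reasoning
  B = allBits k
  ⟦allEqualTo⟧ : ∀ {n} a (v : Vec (Bits k) n) →
    ⟦ allEqualTo a v ⟧ ≡ prodApply (replicate n (λ b → ⟦ b == a ⟧)) v
  ⟦allEqualTo⟧ a []      = refl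
  ⟦allEqualTo⟧ a (b ∷ v) = trans (⟦∧⟧ (b == a) _) (cong (⟦ b == a ⟧ *_) (⟦allEqualTo⟧ a v))

∑-allEqual-simpleTab : ∀ m k n (ys : Vec (Vec (Bits k) m) (suc n)) → Independent (map positionChars ys) →
  (c : Vec (Bits k) (suc n)) →
  ∑⁺ (allTables m k k) (λ T → ⟦ allEqual (zipWith _⊕_ (map (simpleTab T) ys) c) ⟧) * (2 ^ k) ^ n
    ≡ List⁺.length (allTables m k k)
∑-allEqual-simpleTab m k n ys indep c = *-cancelʳ-≡ _ _ (2 ^ k) {{m^n≢0 2 k}} (begin
  X * (2 ^ k) ^ n * 2 ^ k
    ≡⟨ trans (*-assoc X _ (2 ^ k)) (cong (X *_) (*-comm ((2 ^ k) ^ n) (2 ^ k))) ⟩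
  X * (2 ^ k) ^ suc n
    ≡⟨ simpleTab-equidistributed m k k (suc n) ys indep (λ v → ⟦ allEqual (zipWith _⊕_ v c) ⟧) ⟩
  List⁺.length (allTables m k k) * ∑⁺ (allVecs (suc n) (allBits k)) (λ v → ⟦ allEqual (zipWith _⊕_ v c) ⟧)
    ≡⟨ cong (List⁺.length (allTables m k k) *_)
            (trans (∑-allVecs-⊕ (suc n) k c (λ v → ⟦ allEqual v ⟧)) (∑-allEqual k n)) ⟩
  List⁺.length (allTables m k k) * 2 ^ k  ∎)
  where
  open ≡-Reasoning
  X = ∑⁺ (allTables m k k) (λ T → ⟦ allEqual (zipWith _⊕_ (map (simpleTab T) ys) c) ⟧)

∑-allDerTabs-suc : ∀ k d m (F : DerTabs k (suc d) m → ℕ) →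
  ∑⁺ (allDerTabs k (suc d) m) F
    ≡ ∑⁺ (allTables (suc m) k k) (λ t → ∑⁺ (allDerTabs k d (suc m)) (λ ts → F (t , ts)))
∑-allDerTabs-suc k d m F =
  trans (∑⁺-concatMap (λ t → List⁺.map (t ,_) (allDerTabs k d (suc m))) F (allTables (suc m) k k))
        (∑-cong (toList (allTables (suc m) k k)) (λ t → ∑⁺-map (t ,_) F (allDerTabs k d (suc m))))

indepColliding : ∀ {A : Set} {k m n} → (A → Vec (Bits k) m × Bits k) → Vec A n → ℕ
indepColliding D t = ⟦ linIndep (Vec.toList (map (proj₁ ∘ D) t)) ⟧ * ⟦ allEqual (map (proj₂ ∘ D) t) ⟧

indepColliding-map : ∀ {A B : Set} {k m n} (D : B → Vec (Bits k) m × Bits k) (f : A → B) (t : Vec A n) →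
  indepColliding D (map f t) ≡ indepColliding (D ∘ f) t
indepColliding-map D f t =
  cong₂ (λ ps ls → ⟦ linIndep (Vec.toList ps) ⟧ * ⟦ allEqual ls ⟧) (sym (map-∘ _ f t)) (sym (map-∘ _ f t))

∑-indepColliding-lastTable : ∀ m k n (prefixes : Vec (Vec (Bits k) m) (suc n)) (offsets : Vec (Bits k) (suc n)) →
  ∑⁺ (allTables m k k) (λ T → ⟦ linIndep (Vec.toList prefixes) ⟧
                              * ⟦ allEqual (zipWith _⊕_ (map (simpleTab T) prefixes) offsets) ⟧) * (2 ^ k) ^ n
    ≤ List⁺.length (allTables m k k)
∑-indepColliding-lastTable m k n prefixes offsets
  rewrite ∑-*ˡ ⟦ linIndep (Vec.toList prefixes) ⟧
               (λ T → ⟦ allEqual (zipWith _⊕_ (map (simpleTab T) prefixes) offsets) ⟧) (toList (allTables m k k))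
  with linIndep (Vec.toList prefixes) in indep
... | false = z≤n
... | true  = ≤-reflexive (trans (cong (_* (2 ^ k) ^ n) (+-identityʳ (∑⁺ (allTables m k k) (λ T →
                                    ⟦ allEqual (zipWith _⊕_ (map (simpleTab T) prefixes) offsets) ⟧))))
                                 (∑-allEqual-simpleTab m k n prefixes (linIndep⇒Independent prefixes indep) offsets))

-- a prefix x̃₁⋯x̃ⱼ₋₁ together with the current character x̃ⱼ
State : ℕ → ℕ → Set
State k m = Vec (Bits k) m × Bits k

joinState : ∀ {k m} → State k m → Vec (Bits k) (suc m)
joinState s = proj₁ s ∷ʳ proj₂ s

deriveState : ∀ {k d m} → DerTabs k d m → State k m → Vec (Bits k) (L d m) × Bits k
deriveState ts s = deriveRest ts (proj₁ s) (proj₂ s)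

∑-deriveRest-indepColliding : ∀ k d m n (st : Vec (State k m) (suc n)) →
  ∑⁺ (allDerTabs k (suc d) m) (λ ts → indepColliding (deriveState ts) st) * (2 ^ k) ^ n
    ≤ List⁺.length (allDerTabs k (suc d) m)
∑-deriveRest-indepColliding k zero m n st = begin
  ∑⁺ (allDerTabs k 1 m) (λ ts → indepColliding (deriveState ts) st) * (2 ^ k) ^ n
    ≡⟨ cong (_* (2 ^ k) ^ n) (trans (∑-allDerTabs-suc k 0 m _) (∑-cong (toList Ts) (λ t →
         trans (+-identityʳ _)
               (cong (λ ls → ⟦ linIndep (Vec.toList prefixes) ⟧ * ⟦ allEqual ls ⟧)
                     (trans (map-∘ (simpleTab t) joinState st) (sym (zipWith-identityʳ ⊕-identityʳ _))))))) ⟩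
  ∑⁺ Ts (λ t → ⟦ linIndep (Vec.toList prefixes) ⟧
               * ⟦ allEqual (zipWith _⊕_ (map (simpleTab t) prefixes) (replicate (suc n) 𝟎)) ⟧) * (2 ^ k) ^ n
    ≤⟨ ∑-indepColliding-lastTable (suc m) k n prefixes (replicate (suc n) 𝟎) ⟩
  List⁺.length Ts
    ≡⟨ trans (length≡∑⁺ Ts) (sym (∑-allDerTabs-suc k 0 m (λ _ → 1))) ⟩
  ∑⁺ (allDerTabs k 1 m) (λ _ → 1)
    ≡⟨ sym (length≡∑⁺ (allDerTabs k 1 m)) ⟩
  List⁺.length (allDerTabs k 1 m)  ∎
  where
  open ≤-Reasoning
  Ts = allTables (suc m) k k
  prefixes = map joinState st
∑-deriveRest-indepColliding k (suc d) m n st = begin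
  ∑⁺ (allDerTabs k (suc (suc d)) m) (λ ts → indepColliding (deriveState ts) st) * (2 ^ k) ^ n
    ≡⟨ cong (_* (2 ^ k) ^ n) (trans (∑-allDerTabs-suc k (suc d) m (λ ts → indepColliding (deriveState ts) st))
         (∑-cong (toList Ts) (λ t →
         ∑-cong (toList (Ts′)) (λ ts → sym (indepColliding-map (deriveState ts) (next t) st))))) ⟩
  ∑⁺ Ts (λ t → ∑⁺ Ts′ (λ ts → indepColliding (deriveState ts) (map (next t) st))) * (2 ^ k) ^ n
    ≡⟨ sym (∑-*ʳ ((2 ^ k) ^ n) (λ t → ∑⁺ Ts′ (λ ts → indepColliding (deriveState ts) (map (next t) st)))
                (toList Ts)) ⟩
  ∑⁺ Ts (λ t → ∑⁺ Ts′ (λ ts → indepColliding (deriveState ts) (map (next t) st)) * (2 ^ k) ^ n)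
    ≤⟨ ∑-mono-≤ (toList Ts) (λ t → ∑-deriveRest-indepColliding k d (suc m) n (map (next t) st)) ⟩
  ∑⁺ Ts (λ t → List⁺.length Ts′)
    ≡⟨ trans (∑-cong (toList Ts) (λ t → length≡∑⁺ Ts′)) (sym (∑-allDerTabs-suc k (suc d) m (λ _ → 1))) ⟩
  ∑⁺ (allDerTabs k (suc (suc d)) m) (λ _ → 1)
    ≡⟨ sym (length≡∑⁺ (allDerTabs k (suc (suc d)) m)) ⟩
  List⁺.length (allDerTabs k (suc (suc d)) m)  ∎
  where
  open ≤-Reasoning
  Ts = allTables (suc m) k k
  Ts′ = allDerTabs k (suc d) (suc m)
  next : Tables (suc m) k k → State k m → State k (suc m)
  next t s = joinState s , simpleTab t (joinState s)

initialState : ∀ {k c'} → Tables c' k k → Key k c' → State k c'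
initialState h₀ x = init x , last x ⊕ simpleTab h₀ (init x)

∑-derived-indepColliding : ∀ k c' d n (t : Vec (Key k c') (suc n)) →
  ∑⁺ (allTables c' k k) (λ h₀ → ∑⁺ (allDerTabs k d c') (λ hd →
    indepColliding (deriveState hd ∘ initialState h₀) t)) * (2 ^ k) ^ n
    ≤ List⁺.length (allTables c' k k) * List⁺.length (allDerTabs k d c')
∑-derived-indepColliding k c' zero n t = begin
  ∑⁺ T₀ (λ h₀ → indepColliding (initialState h₀) t + 0) * (2 ^ k) ^ n
    ≡⟨ cong (_* (2 ^ k) ^ n) (∑-cong (toList T₀) (λ h₀ → trans (+-identityʳ _)
         (cong (λ ls → ⟦ linIndep (Vec.toList (map init t)) ⟧ * ⟦ allEqual ls ⟧) (lastChars h₀ t)))) ⟩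
  ∑⁺ T₀ (λ h₀ → ⟦ linIndep (Vec.toList (map init t)) ⟧
               * ⟦ allEqual (zipWith _⊕_ (map (simpleTab h₀) (map init t)) (map last t)) ⟧) * (2 ^ k) ^ n
    ≤⟨ ∑-indepColliding-lastTable c' k n (map init t) (map last t) ⟩
  List⁺.length T₀
    ≡⟨ sym (*-identityʳ _) ⟩
  List⁺.length T₀ * 1  ∎
  where
  open ≤-Reasoning
  T₀ = allTables c' k k
  lastChars : ∀ {n} h₀ (t : Vec (Key k c') n) →
    map (proj₂ ∘ initialState h₀) t ≡ zipWith _⊕_ (map (simpleTab h₀) (map init t)) (map last t)
  lastChars h₀ []      = refl
  lastChars h₀ (x ∷ t) = cong₂ _∷_ (⊕-comm (last x) _) (lastChars h₀ t)
∑-derived-indepColliding k c' (suc d) n t = begin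
  ∑⁺ T₀ (λ h₀ → ∑⁺ TD (λ hd → indepColliding (deriveState hd ∘ initialState h₀) t)) * (2 ^ k) ^ n
    ≡⟨ sym (∑-*ʳ ((2 ^ k) ^ n) (λ h₀ → ∑⁺ TD (λ hd → indepColliding (deriveState hd ∘ initialState h₀) t))
                (toList T₀)) ⟩
  ∑⁺ T₀ (λ h₀ → ∑⁺ TD (λ hd → indepColliding (deriveState hd ∘ initialState h₀) t) * (2 ^ k) ^ n)
    ≡⟨ ∑-cong (toList T₀) (λ h₀ → cong (_* (2 ^ k) ^ n) (∑-cong (toList TD) (λ hd →
         sym (indepColliding-map (deriveState hd) (initialState h₀) t)))) ⟩
  ∑⁺ T₀ (λ h₀ → ∑⁺ TD (λ hd → indepColliding (deriveState hd) (map (initialState h₀) t)) * (2 ^ k) ^ n)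
    ≤⟨ ∑-mono-≤ (toList T₀) (λ h₀ → ∑-deriveRest-indepColliding k d c' n (map (initialState h₀) t)) ⟩
  ∑⁺ T₀ (λ _ → List⁺.length TD)
    ≡⟨ ∑⁺-const T₀ _ ⟩
  List⁺.length T₀ * List⁺.length TD  ∎
  where
  open ≤-Reasoning
  T₀ = allTables c' k k
  TD = allDerTabs k (suc d) c'

∑-allTornado : ∀ k r c' d (F : Tornado k r c' d → ℕ) →
  ∑⁺ (allTornado k r c' d) F
    ≡ ∑⁺ (allTables c' k k) (λ h₀ → ∑⁺ (allDerTabs k d c') (λ hd →
        ∑⁺ (allTables (suc (L d c')) k r) (λ ĥ → F (tornado h₀ hd ĥ))))
∑-allTornado k r c' d F =
  trans (∑⁺-concatMap (λ h₀ → concatMap (λ hd → List⁺.map (tornado h₀ hd) TH) (allDerTabs k d c')) F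
                      (allTables c' k k))
        (∑-cong (toList (allTables c' k k)) (λ h₀ →
          trans (∑⁺-concatMap (λ hd → List⁺.map (tornado h₀ hd) TH) F (allDerTabs k d c'))
                (∑-cong (toList (allDerTabs k d c')) (λ hd → ∑⁺-map (tornado h₀ hd) F TH))))
  where TH = allTables (suc (L d c')) k r

length-allTornado : ∀ k r c' d → List⁺.length (allTornado k r c' d)
  ≡ List⁺.length (allTables c' k k)
    * (List⁺.length (allDerTabs k d c') * List⁺.length (allTables (suc (L d c')) k r))
length-allTornado k r c' d =
  trans (length≡∑⁺ (allTornado k r c' d))
  (trans (∑-allTornado k r c' d (λ _ → 1))
  (trans (∑-cong (toList T₀) (λ h₀ →
           trans (∑-cong (toList TD) (λ hd → sym (length≡∑⁺ TH))) (∑⁺-const TD _)))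
         (∑⁺-const T₀ _)))
  where
  T₀ = allTables c' k k
  TD = allDerTabs k d c'
  TH = allTables (suc (L d c')) k r

Independent-single : ∀ {k m} (y : Vec (Bits k) (suc m)) → Independent (map positionChars (y ∷ []))
Independent-single         y       (false ∷ []) _         = refl
Independent-single {k} (a ∷ y) (true ∷ [])  y·true≡𝟎 =
  ⊥-elim (oneHot≢𝟎 k a (proj₁ (++-≡𝟎 (oneHot k a) (positionChars y)
                                      (trans (sym (⊕-identityʳ _)) y·true≡𝟎))))
  where
  oneHot≢𝟎 : ∀ k (a : Bits k) → oneHot k a ≢ 𝟎
  oneHot≢𝟎 zero    []          ()
  oneHot≢𝟎 (suc k) (false ∷ a) eq = oneHot≢𝟎 k a (proj₁ (++-≡𝟎 (oneHot k a) _ eq))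
  oneHot≢𝟎 (suc k) (true ∷ a)  eq = oneHot≢𝟎 k a (proj₂ (++-≡𝟎 _ (oneHot k a) eq))

hash-equidistributed : ∀ {k r c' d} (x : Key k c') (F : Bits r → ℕ) →
  ∑⁺ (allTornado k r c' d) (λ h → F (hash h x)) * 2 ^ r ≡ List⁺.length (allTornado k r c' d) * ∑⁺ (allBits r) F
hash-equidistributed {k} {r} {c'} {d} x F = begin
  ∑⁺ (allTornado k r c' d) (λ h → F (hash h x)) * 2 ^ r
    ≡⟨ cong (_* 2 ^ r) (∑-allTornado k r c' d (λ h → F (hash h x))) ⟩
  ∑⁺ T₀ (λ h₀ → ∑⁺ TD (λ hd → ∑⁺ TH (λ ĥ → F (hash (tornado h₀ hd ĥ) x)))) * 2 ^ r
    ≡⟨ ∑∑-*ʳ (toList T₀) (toList TD) (λ h₀ hd → ∑⁺ TH (λ ĥ → F (hash (tornado h₀ hd ĥ) x))) (2 ^ r) ⟩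
  ∑⁺ T₀ (λ h₀ → ∑⁺ TD (λ hd → ∑⁺ TH (λ ĥ → F (hash (tornado h₀ hd ĥ) x)) * 2 ^ r))
    ≡⟨ ∑-cong (toList T₀) (λ h₀ → ∑-cong (toList TD) (λ hd → single h₀ hd)) ⟩
  ∑⁺ T₀ (λ h₀ → ∑⁺ TD (λ hd → List⁺.length TH * ∑⁺ (allBits r) F))
    ≡⟨ trans (∑-cong (toList T₀) (λ h₀ → ∑⁺-const TD _)) (∑⁺-const T₀ _) ⟩
  List⁺.length T₀ * (List⁺.length TD * (List⁺.length TH * ∑⁺ (allBits r) F))
    ≡⟨ trans (cong (List⁺.length T₀ *_) (sym (*-assoc (List⁺.length TD) (List⁺.length TH) (∑⁺ (allBits r) F))))
             (sym (*-assoc (List⁺.length T₀) (List⁺.length TD * List⁺.length TH) (∑⁺ (allBits r) F))) ⟩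
  List⁺.length T₀ * (List⁺.length TD * List⁺.length TH) * ∑⁺ (allBits r) F
    ≡⟨ cong (_* ∑⁺ (allBits r) F) (sym (length-allTornado k r c' d)) ⟩
  List⁺.length (allTornado k r c' d) * ∑⁺ (allBits r) F  ∎
  where
  open ≡-Reasoning
  T₀ = allTables c' k k
  TD = allDerTabs k d c'
  TH = allTables (suc (L d c')) k r
  single : ∀ h₀ hd →
    ∑⁺ TH (λ ĥ → F (hash (tornado h₀ hd ĥ) x)) * 2 ^ r ≡ List⁺.length TH * ∑⁺ (allBits r) F
  single h₀ hd =
    trans (cong (∑⁺ TH (λ ĥ → F (hash (tornado h₀ hd ĥ) x)) *_) (sym (*-identityʳ (2 ^ r))))
    (trans (simpleTab-equidistributed (suc (L d c')) k r 1 (key ∷ []) (Independent-single key) (F ∘ head))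
           (cong (List⁺.length TH *_) (trans (∑-allVecs-suc 0 (allBits r) (F ∘ head))
                                             (∑-cong (toList (allBits r)) (λ v → +-identityʳ (F v))))))
    where key = joinState (deriveState hd (initialState h₀ x))

selecting : ∀ {k r c'} → Selector k r c' → Key k c' → ℕ
selecting {r = r} φ x = ∑⁺ (allBits r) (λ v → ⟦ φ x v ⟧)

∑-length-Xset : ∀ {k r c' d} (φ : Selector k r c') →
  ∑⁺ (allTornado k r c' d) (λ h → List.length (Xset φ h)) * 2 ^ r
    ≡ List⁺.length (allTornado k r c' d) * ∑ (allKeys k c') (selecting φ)
∑-length-Xset {k} {r} {c'} {d} φ = begin
  ∑⁺ H (λ h → List.length (Xset φ h)) * 2 ^ r
    ≡⟨ cong (_* 2 ^ r) (∑-cong (toList H) (λ h → length-filterᵇ (λ x → φ x (hash h x)) (allKeys k c'))) ⟩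
  ∑⁺ H (λ h → ∑ (allKeys k c') (λ x → ⟦ φ x (hash h x) ⟧)) * 2 ^ r
    ≡⟨ cong (_* 2 ^ r) (∑-comm (λ h x → ⟦ φ x (hash h x) ⟧) (toList H) (allKeys k c')) ⟩
  ∑ (allKeys k c') (λ x → ∑⁺ H (λ h → ⟦ φ x (hash h x) ⟧)) * 2 ^ r
    ≡⟨ sym (∑-*ʳ (2 ^ r) (λ x → ∑⁺ H (λ h → ⟦ φ x (hash h x) ⟧)) (allKeys k c')) ⟩
  ∑ (allKeys k c') (λ x → ∑⁺ H (λ h → ⟦ φ x (hash h x) ⟧) * 2 ^ r)
    ≡⟨ ∑-cong (allKeys k c') (λ x → hash-equidistributed {d = d} x (λ v → ⟦ φ x v ⟧)) ⟩
  ∑ (allKeys k c') (λ x → List⁺.length H * selecting φ x)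
    ≡⟨ ∑-*ˡ (List⁺.length H) (selecting φ) (allKeys k c') ⟩
  List⁺.length H * ∑ (allKeys k c') (selecting φ)  ∎
  where
  open ≡-Reasoning
  H = allTornado k r c' d

indepCollidingSelected : ∀ {k r c' d n} → Selector k r c' → Vec (Key k c') n → Tornado k r c' d → ℕ
indepCollidingSelected φ t h =
  indepColliding (derived h) t * prodApply (map (λ x v → ⟦ φ x v ⟧) t) (map (hash h) t)

indepColliding-*-cong : ∀ {A : Set} {k m n} (D : A → Vec (Bits k) m × Bits k) (t : Vec A n) {x y} →
  (linIndep (Vec.toList (map (proj₁ ∘ D) t)) ≡ true → x ≡ y) → indepColliding D t * x ≡ indepColliding D t * y
indepColliding-*-cong D t x≡y with linIndep (Vec.toList (map (proj₁ ∘ D) t))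
... | false = refl
... | true  = cong (λ z → ⟦ true ⟧ * ⟦ allEqual (map (proj₂ ∘ D) t) ⟧ * z) (x≡y refl)

module SelectedTuple {k r c' d n : ℕ} (φ : Selector k r c') (t : Vec (Key k c') (suc n)) where

  private
    T₀ : List⁺ (Tables c' k k)
    T₀ = allTables c' k k
    TD : List⁺ (DerTabs k d c')
    TD = allDerTabs k d c'
    TH : List⁺ (Tables (suc (L d c')) k r)
    TH = allTables (suc (L d c')) k r
    Φ : Vec (Bits r → ℕ) (suc n)
    Φ = map (λ x v → ⟦ φ x v ⟧) t
    Π K R : ℕ
    Π = prodSum (allBits r) Φ
    K = (2 ^ k) ^ n
    R = (2 ^ r) ^ suc n

    I : Tables c' k k → DerTabs k d c' → ℕ
    I h₀ hd = indepColliding (deriveState hd ∘ initialState h₀) t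

    selected : Tables c' k k → DerTabs k d c' → ℕ
    selected h₀ hd = ∑⁺ TH (λ ĥ → prodApply Φ (map (hash (tornado h₀ hd ĥ)) t))

  -- given independent prefixes, the full derived keys are independent and so hash uniformly
  indepColliding-selected : ∀ h₀ hd → I h₀ hd * (selected h₀ hd * R) ≡ I h₀ hd * (List⁺.length TH * Π)
  indepColliding-selected h₀ hd = indepColliding-*-cong (deriveState hd ∘ initialState h₀) t λ indep → begin
    selected h₀ hd * R
      ≡⟨ cong (_* R) (∑-cong (toList TH) (λ ĥ → cong (prodApply Φ) (map-∘ (simpleTab ĥ) key t))) ⟩
    ∑⁺ TH (λ ĥ → prodApply Φ (map (simpleTab ĥ) (map key t))) * R
      ≡⟨ simpleTab-equidistributed (suc (L d c')) k r (suc n) (map key t)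
           (linIndep-prefixes⇒Independent t (proj₁ ∘ D) (proj₂ ∘ D) indep) (prodApply Φ) ⟩
    List⁺.length TH * ∑⁺ (allVecs (suc n) (allBits r)) (prodApply Φ)
      ≡⟨ cong (List⁺.length TH *_) (∑-allVecs-prodApply (suc n) (allBits r) Φ) ⟩
    List⁺.length TH * Π  ∎
    where
    open ≡-Reasoning
    D = deriveState hd ∘ initialState h₀
    key = joinState ∘ D

  ∑-indepCollidingSelected :
    ∑⁺ (allTornado k r c' d) (indepCollidingSelected φ t) * (K * R) ≤ List⁺.length (allTornado k r c' d) * Π
  ∑-indepCollidingSelected = begin
    ∑⁺ (allTornado k r c' d) (indepCollidingSelected φ t) * (K * R)
      ≡⟨ cong (_* (K * R)) (trans (∑-allTornado k r c' d (indepCollidingSelected φ t))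
           (∑-cong (toList T₀) (λ h₀ → ∑-cong (toList TD) (λ hd → ∑-*ˡ (I h₀ hd) _ (toList TH))))) ⟩
    ∑⁺ T₀ (λ h₀ → ∑⁺ TD (λ hd → I h₀ hd * selected h₀ hd)) * (K * R)
      ≡⟨ ∑∑-*ʳ (toList T₀) (toList TD) (λ h₀ hd → I h₀ hd * selected h₀ hd) (K * R) ⟩
    ∑⁺ T₀ (λ h₀ → ∑⁺ TD (λ hd → I h₀ hd * selected h₀ hd * (K * R)))
      ≡⟨ ∑-cong (toList T₀) (λ h₀ → ∑-cong (toList TD) (λ hd → regroup h₀ hd)) ⟩
    ∑⁺ T₀ (λ h₀ → ∑⁺ TD (λ hd → I h₀ hd * K * (List⁺.length TH * Π)))
      ≡⟨ sym (∑∑-*ʳ (toList T₀) (toList TD) (λ h₀ hd → I h₀ hd * K) (List⁺.length TH * Π)) ⟩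
    ∑⁺ T₀ (λ h₀ → ∑⁺ TD (λ hd → I h₀ hd * K)) * (List⁺.length TH * Π)
      ≡⟨ cong (_* (List⁺.length TH * Π)) (sym (∑∑-*ʳ (toList T₀) (toList TD) I K)) ⟩
    ∑⁺ T₀ (λ h₀ → ∑⁺ TD (I h₀)) * K * (List⁺.length TH * Π)
      ≤⟨ *-monoˡ-≤ (List⁺.length TH * Π) (∑-derived-indepColliding k c' d n t) ⟩
    List⁺.length T₀ * List⁺.length TD * (List⁺.length TH * Π)
      ≡⟨ reassociate (List⁺.length T₀) (List⁺.length TD) (List⁺.length TH) Π ⟩
    List⁺.length T₀ * (List⁺.length TD * List⁺.length TH) * Π
      ≡⟨ cong (_* Π) (sym (length-allTornado k r c' d)) ⟩
    List⁺.length (allTornado k r c' d) * Π  ∎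
    where
    open ≤-Reasoning
    reassociate : ∀ a b c p → a * b * (c * p) ≡ a * (b * c) * p
    reassociate = solve-∀
    regroup : ∀ h₀ hd → I h₀ hd * selected h₀ hd * (K * R) ≡ I h₀ hd * K * (List⁺.length TH * Π)
    regroup h₀ hd = begin-equality
      I h₀ hd * selected h₀ hd * (K * R)      ≡⟨ shuffle (I h₀ hd) (selected h₀ hd) K R ⟩
      I h₀ hd * (selected h₀ hd * R) * K      ≡⟨ cong (_* K) (indepColliding-selected h₀ hd) ⟩
      I h₀ hd * (List⁺.length TH * Π) * K     ≡⟨ *-CS.xy∙z≈xz∙y (I h₀ hd) _ K ⟩
      I h₀ hd * K * (List⁺.length TH * Π)     ∎
      where
      shuffle : ∀ i s a b → i * s * (a * b) ≡ i * (s * b) * a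
      shuffle = solve-∀

-- Counting tuples in a bucket

module Distinct {A : Set} (_≟_ : DecidableEquality A) where
  open BoolEquality _≟_

  distinct : List A → Bool
  distinct []       = true
  distinct (y ∷ ys) = not (any (y ≡ᵇ_) ys) ∧ distinct ys

  ⟦any⟧≡∑ : ∀ x ys → distinct ys ≡ true → ⟦ any (x ≡ᵇ_) ys ⟧ ≡ ∑ ys (λ y → ⟦ x ≡ᵇ y ⟧)
  ⟦any⟧≡∑ x []       _        = refl
  ⟦any⟧≡∑ x (y ∷ ys) distinct≡true with x ≡ᵇ y in x≡ᵇy
  ... | true  = cong suc (trans (cong ⟦_⟧ (sym y∉ys)) (⟦any⟧≡∑ x ys (∧-true-right distinct≡true)))
    where
    not-true : ∀ {a b} → (not a ∧ b) ≡ true → a ≡ false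
    not-true {false} _ = refl
    y∉ys : any (x ≡ᵇ_) ys ≡ false
    y∉ys rewrite ≡ᵇ⇒≡ x≡ᵇy = not-true distinct≡true
  ... | false = ⟦any⟧≡∑ x ys (∧-true-right distinct≡true)

  any-select : ∀ {n} (p : A → Bool) (c : Vec Bool n) (t : Vec A n) →
    any p (select c t) ≡ true → any p (Vec.toList t) ≡ true
  any-select p []          []      ()
  any-select p (true ∷ c)  (x ∷ t) any≡true with p x
  ... | true  = refl
  ... | false = any-select p c t any≡true
  any-select p (false ∷ c) (x ∷ t) any≡true with p x
  ... | true  = refl
  ... | false = any-select p c t any≡true

  distinct-select : ∀ {n} (c : Vec Bool n) (t : Vec A n) →
    distinct (Vec.toList t) ≡ true → distinct (select c t) ≡ true
  distinct-select []          []      _ = refl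
  distinct-select (false ∷ c) (x ∷ t) distinct≡true = distinct-select c t (∧-true-right distinct≡true)
  distinct-select (true ∷ c)  (x ∷ t) distinct≡true
    with any (x ≡ᵇ_) (select c t) in x∈sel | any (x ≡ᵇ_) (Vec.toList t) in x∈t
  ... | false | _     = distinct-select c t (∧-true-right distinct≡true)
  ... | true  | false = ⊥-elim (false≢true (trans (sym x∈t) (any-select (x ≡ᵇ_) c t x∈sel)))

  distinctAll : (A → Bool) → List A → Bool
  distinctAll Q ys = distinct ys ∧ all Q ys

  module _ (xs : List⁺ A) (once : EachOnce xs) where

    private
      besides : (A → Bool) → A → A → Bool
      besides Q x y = Q y ∧ not (x ≡ᵇ y)

      all-besides : ∀ Q x ys → all (besides Q x) ys ≡ true → all Q ys ≡ true × any (x ≡ᵇ_) ys ≡ false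
      all-besides Q x []       _ = refl , refl
      all-besides Q x (y ∷ ys) all≡true with Q y | x ≡ᵇ y
      ... | true  | false = all-besides Q x ys all≡true
      all-besides Q x (y ∷ ys) () | true  | true
      all-besides Q x (y ∷ ys) () | false | _

      distinctAll-∷ : ∀ Q x ys → Q x ≡ true →
        ⟦ distinctAll (besides Q x) ys ⟧ ≤ ⟦ distinctAll Q (x ∷ ys) ⟧
      distinctAll-∷ Q x ys Qx rewrite Qx with distinct ys | all (besides Q x) ys in all≡true
      ... | false | _     = z≤n
      ... | true  | false = z≤n
      ... | true  | true
        rewrite proj₁ (all-besides Q x ys all≡true) | proj₂ (all-besides Q x ys all≡true) = s≤s z≤n

      #besides : ∀ Q x → ∑⁺ xs (λ y → ⟦ Q y ⟧) ≤ 1 + ∑⁺ xs (λ y → ⟦ besides Q x y ⟧)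
      #besides Q x = begin
        ∑⁺ xs (λ y → ⟦ Q y ⟧)
          ≤⟨ ∑-mono-≤ (toList xs) split ⟩
        ∑⁺ xs (λ y → ⟦ y ≡ᵇ x ⟧ + ⟦ besides Q x y ⟧)
          ≡⟨ ∑-+ (λ y → ⟦ y ≡ᵇ x ⟧) (λ y → ⟦ besides Q x y ⟧) (toList xs) ⟩
        ∑⁺ xs (λ y → ⟦ y ≡ᵇ x ⟧) + ∑⁺ xs (λ y → ⟦ besides Q x y ⟧)
          ≡⟨ cong (_+ ∑⁺ xs (λ y → ⟦ besides Q x y ⟧)) (once x) ⟩
        1 + ∑⁺ xs (λ y → ⟦ besides Q x y ⟧)  ∎
        where
        open ≤-Reasoning
        split : ∀ y → ⟦ Q y ⟧ ≤ ⟦ y ≡ᵇ x ⟧ + ⟦ besides Q x y ⟧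
        split y rewrite ≡ᵇ-sym y x with Q y | x ≡ᵇ y
        ... | false | _     = z≤n
        ... | true  | true  = s≤s z≤n
        ... | true  | false = s≤s z≤n

    !≤∑-distinctAll : ∀ n (Q : A → Bool) → n ≤ ∑⁺ xs (λ x → ⟦ Q x ⟧) →
      n ! ≤ ∑⁺ (allVecs n xs) (λ t → ⟦ distinctAll Q (Vec.toList t) ⟧)
    !≤∑-distinctAll zero    Q _    = s≤s z≤n
    !≤∑-distinctAll (suc n) Q n<#Q = begin
      suc n * n !
        ≤⟨ *-monoˡ-≤ (n !) n<#Q ⟩
      ∑⁺ xs (λ x → ⟦ Q x ⟧) * n !
        ≡⟨ sym (∑-*ʳ (n !) (λ x → ⟦ Q x ⟧) (toList xs)) ⟩
      ∑⁺ xs (λ x → ⟦ Q x ⟧ * n !)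
        ≤⟨ ∑-mono-≤ (toList xs) first ⟩
      ∑⁺ xs (λ x → ∑⁺ (allVecs n xs) (λ t → ⟦ distinctAll Q (x ∷ Vec.toList t) ⟧))
        ≡⟨ sym (∑-allVecs-suc n xs (λ t → ⟦ distinctAll Q (Vec.toList t) ⟧)) ⟩
      ∑⁺ (allVecs (suc n) xs) (λ t → ⟦ distinctAll Q (Vec.toList t) ⟧)  ∎
      where
      open ≤-Reasoning
      first : ∀ x → ⟦ Q x ⟧ * n ! ≤ ∑⁺ (allVecs n xs) (λ t → ⟦ distinctAll Q (x ∷ Vec.toList t) ⟧)
      first x = byCases (Q x) refl
        where
        byCases : ∀ b → Q x ≡ b →
          ⟦ b ⟧ * n ! ≤ ∑⁺ (allVecs n xs) (λ t → ⟦ distinctAll Q (x ∷ Vec.toList t) ⟧)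
        byCases false _  = z≤n
        byCases true  Qx = begin
          1 * n !
            ≡⟨ *-identityˡ (n !) ⟩
          n !
            ≤⟨ !≤∑-distinctAll n (besides Q x) (≤-pred (≤-trans n<#Q (#besides Q x))) ⟩
          ∑⁺ (allVecs n xs) (λ t → ⟦ distinctAll (besides Q x) (Vec.toList t) ⟧)
            ≤⟨ ∑-mono-≤ (toList (allVecs n xs)) (λ t → distinctAll-∷ Q x (Vec.toList t) Qx) ⟩
          ∑⁺ (allVecs n xs) (λ t → ⟦ distinctAll Q (x ∷ Vec.toList t) ⟧)  ∎

module Buckets {k r c' d : ℕ} (φ : Selector k r c') (h : Tornado k r c' d) where

  _≟K_ : DecidableEquality (Key k c')
  _≟K_ = ≡-dec (≡-dec _≟B_)

  open BoolEquality _≟K_ using (_≡ᵇ_; ≡ᵇ⇒≡)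
  open BoolEquality (≡-dec {n = k} _≟B_) using () renaming (≡ᵇ⇒≡ to ==⇒≡; ≡ᵇ-sym to ==-sym)
  open Distinct _≟K_

  Keys : List⁺ (Key k c')
  Keys = allVecs (suc c') (allBits k)

  EachOnce-Keys : EachOnce[ _≟K_ ] Keys
  EachOnce-Keys = EachOnce-allVecs (≡-dec _≟B_) (allBits k) (EachOnce-allBits k) (suc c')

  isSelected : Key k c' → Bool
  isSelected x = φ x (hash h x)

  prefix : Key k c' → Vec (Bits k) (L d c')
  prefix x = proj₁ (derived h x)

  bucket : Key k c' → Bits k
  bucket x = proj₂ (derived h x)

  X : List (Key k c')
  X = Xset φ h

  X-eachOnce : ∀ y → isSelected y ≡ true → ∑ X (λ x → ⟦ x ≡ᵇ y ⟧) ≡ 1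
  X-eachOnce y selected = trans (∑-filterᵇ isSelected (λ x → ⟦ x ≡ᵇ y ⟧) (toList Keys))
                                (trans (∑-cong (toList Keys) only-y) (EachOnce-Keys y))
    where
    only-y : ∀ x → ⟦ isSelected x ⟧ * ⟦ x ≡ᵇ y ⟧ ≡ ⟦ x ≡ᵇ y ⟧
    only-y x with x ≡ᵇ y in x≡ᵇy
    ... | false = *-zeroʳ ⟦ isSelected x ⟧
    ... | true  rewrite ≡ᵇ⇒≡ x≡ᵇy | selected = refl

  count-X∩ : ∀ ys → distinct ys ≡ true → all isSelected ys ≡ true → ∀ p →
    count p (filterᵇ (λ x → any (x ≡ᵇ_) ys) X) ≡ count p ys
  count-X∩ ys distinct≡true selected p = begin
    count p (filterᵇ (λ x → any (x ≡ᵇ_) ys) X)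
      ≡⟨ count-filterᵇ p (λ x → any (x ≡ᵇ_) ys) X ⟩
    ∑ X (λ x → ⟦ any (x ≡ᵇ_) ys ⟧ * ⟦ p x ⟧)
      ≡⟨ ∑-cong X (λ x → trans (cong (_* ⟦ p x ⟧) (⟦any⟧≡∑ x ys distinct≡true))
                               (sym (∑-*ʳ ⟦ p x ⟧ (λ y → ⟦ x ≡ᵇ y ⟧) ys))) ⟩
    ∑ X (λ x → ∑ ys (λ y → ⟦ x ≡ᵇ y ⟧ * ⟦ p x ⟧))
      ≡⟨ ∑-comm (λ x y → ⟦ x ≡ᵇ y ⟧ * ⟦ p x ⟧) X ys ⟩
    ∑ ys (λ y → ∑ X (λ x → ⟦ x ≡ᵇ y ⟧ * ⟦ p x ⟧))
      ≡⟨ ∑-cong ys (λ y → trans (∑-cong X (λ x → p-at x y))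
                                (∑-*ʳ ⟦ p y ⟧ (λ x → ⟦ x ≡ᵇ y ⟧) X)) ⟩
    ∑ ys (λ y → ∑ X (λ x → ⟦ x ≡ᵇ y ⟧) * ⟦ p y ⟧)
      ≡⟨ ∑-cong-all isSelected ys (λ y sel → trans (cong (_* ⟦ p y ⟧) (X-eachOnce y sel)) (+-identityʳ _))
                    selected ⟩
    ∑ ys (λ y → ⟦ p y ⟧)
      ≡⟨ sym (count≡∑ p ys) ⟩
    count p ys  ∎
    where
    open ≡-Reasoning
    p-at : ∀ x y → ⟦ x ≡ᵇ y ⟧ * ⟦ p x ⟧ ≡ ⟦ x ≡ᵇ y ⟧ * ⟦ p y ⟧
    p-at x y with x ≡ᵇ y in x≡ᵇy
    ... | false = refl
    ... | true  rewrite ≡ᵇ⇒≡ x≡ᵇy = refl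

  -- a dependent subfamily of the prefixes of t yields one of the prefixes of X
  linIndep-tuple : ∀ {n} (t : Vec (Key k c') n) → linIndep (List.map prefix X) ≡ true →
    distinct (Vec.toList t) ≡ true → all isSelected (Vec.toList t) ≡ true →
    linIndep (Vec.toList (map prefix t)) ≡ true
  linIndep-tuple t 𝒥 distinct≡true selected
    with any nonemptyEven (subfamilies (Vec.toList (map prefix t))) in dependent
  ... | false = refl
  ... | true  = ⊥-elim (false≢true (trans (sym (cong not dependentX)) 𝒥))
    where
    witness = any-subfamilies⇒select nonemptyEven (map prefix t) dependent
    ys = select (proj₁ witness) t
    X∩ys = filterᵇ (λ x → any (x ≡ᵇ_) ys) X
    dependentX : any nonemptyEven (subfamilies (List.map prefix X)) ≡ true
    dependentX = any-subfamilies-filterᵇ nonemptyEven prefix (λ x → any (x ≡ᵇ_) ys) X (begin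
      nonemptyEven (List.map prefix X∩ys)
        ≡⟨ nonemptyEven-count (List.map prefix X∩ys) (List.map prefix ys) (λ p →
             trans (count-map p prefix X∩ys)
             (trans (count-X∩ ys (distinct-select (proj₁ witness) t distinct≡true)
                                 (all-select isSelected (proj₁ witness) t selected) (p ∘ prefix))
                    (sym (count-map p prefix ys)))) ⟩
      nonemptyEven (List.map prefix ys)
        ≡⟨ cong nonemptyEven (sym (select-map prefix (proj₁ witness) t)) ⟩
      nonemptyEven (select (proj₁ witness) (map prefix t))
        ≡⟨ proj₂ witness ⟩
      true  ∎)
      where open ≡-Reasoning

  inBucket : Bits k → Key k c' → Bool
  inBucket α x = isSelected x ∧ (bucket x == α)

  length-Xα : ∀ α → List.length (Xα φ h α) ≡ ∑⁺ Keys (λ x → ⟦ inBucket α x ⟧)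
  length-Xα α = trans (count-filterᵇ (λ x → bucket x == α) isSelected (toList Keys))
                      (∑-cong (toList Keys) (λ x → sym (⟦∧⟧ (isSelected x) (bucket x == α))))

  private
    allEqualTo-map : ∀ {n} a (t : Vec (Key k c') n) →
      allEqualTo a (map bucket t) ≡ all (λ y → bucket y == a) (Vec.toList t)
    allEqualTo-map a []      = refl
    allEqualTo-map a (y ∷ t) = cong ((bucket y == a) ∧_) (allEqualTo-map a t)

    allSelected : ∀ {n} (t : Vec (Key k c') n) → all isSelected (Vec.toList t) ≡ true →
      prodApply (map (λ x v → ⟦ φ x v ⟧) t) (map (hash h) t) ≡ 1
    allSelected []      _ = refl
    allSelected (x ∷ t) all≡true with isSelected x
    ... | true = trans (+-identityʳ _) (allSelected t all≡true)

  indepCollidingSelected-bucket : ∀ {n} (x : Key k c') (t : Vec (Key k c') n) α →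
    linIndep (List.map prefix X) ≡ true →
    ⟦ distinctAll (inBucket α) (x ∷ Vec.toList t) ⟧ ≤ ⟦ bucket x == α ⟧ * indepCollidingSelected φ (x ∷ t) h
  indepCollidingSelected-bucket x t α 𝒥 with distinctAll (inBucket α) (x ∷ Vec.toList t) in inα
  ... | false = z≤n
  ... | true  = ≤-reflexive (sym (begin
    ⟦ bucket x == α ⟧ * indepCollidingSelected φ (x ∷ t) h
      ≡⟨ cong₂ (λ a b → ⟦ a ⟧ * (⟦ b ⟧ * ⟦ allEqualTo (bucket x) (map bucket t) ⟧ * selectedAll))
               x∈α (linIndep-tuple (x ∷ t) 𝒥 (∧-true-left inα) (proj₁ selected∧α)) ⟩
    1 * (1 * ⟦ allEqualTo (bucket x) (map bucket t) ⟧ * selectedAll)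
      ≡⟨ cong₂ (λ a b → 1 * (1 * ⟦ a ⟧ * b)) sameBucket (allSelected (x ∷ t) (proj₁ selected∧α)) ⟩
    1  ∎))
    where
    open ≡-Reasoning
    selectedAll = prodApply (map (λ y v → ⟦ φ y v ⟧) (x ∷ t)) (map (hash h) (x ∷ t))
    selected∧α = all-∧⁻ isSelected (λ y → bucket y == α) (x ∷ Vec.toList t)
                        (∧-true-right {distinct (x ∷ Vec.toList t)} inα)
    x∈α : (bucket x == α) ≡ true
    x∈α = ∧-true-left (proj₂ selected∧α)
    sameBucket : allEqualTo (bucket x) (map bucket t) ≡ true
    sameBucket = trans (allEqualTo-map (bucket x) t)
                       (trans (cong (λ a → all (λ y → bucket y == a) (Vec.toList t)) (==⇒≡ x∈α))
                              (∧-true-right (proj₂ selected∧α)))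

  ∑-bucket≤indepCollidingSelected : ∀ {n} (t : Vec (Key k c') (suc n)) → linIndep (List.map prefix X) ≡ true →
    ∑⁺ (allBits k) (λ α → ⟦ distinctAll (inBucket α) (Vec.toList t) ⟧) ≤ indepCollidingSelected φ t h
  ∑-bucket≤indepCollidingSelected (x ∷ t) 𝒥 = begin
    ∑⁺ (allBits k) (λ α → ⟦ distinctAll (inBucket α) (x ∷ Vec.toList t) ⟧)
      ≤⟨ ∑-mono-≤ (toList (allBits k)) (λ α → indepCollidingSelected-bucket x t α 𝒥) ⟩
    ∑⁺ (allBits k) (λ α → ⟦ bucket x == α ⟧ * I)
      ≡⟨ ∑-*ʳ I (λ α → ⟦ bucket x == α ⟧) (toList (allBits k)) ⟩
    ∑⁺ (allBits k) (λ α → ⟦ bucket x == α ⟧) * I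
      ≡⟨ cong (_* I) (trans (∑-cong (toList (allBits k)) (λ α → cong ⟦_⟧ (==-sym (bucket x) α)))
                            (EachOnce-allBits k (bucket x))) ⟩
    1 * I
      ≡⟨ *-identityˡ I ⟩
    I  ∎
    where
    open ≤-Reasoning
    I = indepCollidingSelected φ (x ∷ t) h

  !*Sᵢ*𝟏𝒥≤∑indepCollidingSelected : ∀ n →
    suc n ! * (S φ h (suc n) * 𝟏𝒥 φ h) ≤ ∑⁺ (allVecs (suc n) Keys) (λ t → indepCollidingSelected φ t h)
  !*Sᵢ*𝟏𝒥≤∑indepCollidingSelected n with linIndep (List.map prefix X) in 𝒥
  ... | false = ≤-trans (≤-reflexive (trans (cong (i ! *_) (*-zeroʳ (S φ h i))) (*-zeroʳ (i !)))) z≤n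
    where i = suc n
  ... | true  = begin
    i ! * (S φ h i * 1)
      ≡⟨ cong (i ! *_) (trans (*-identityʳ (S φ h i))
                              (length-filterᵇ (λ α → i ≤ᵇ List.length (Xα φ h α)) (toList B))) ⟩
    i ! * ∑⁺ B (λ α → ⟦ i ≤ᵇ List.length (Xα φ h α) ⟧)
      ≡⟨ trans (*-comm (i !) _) (sym (∑-*ʳ (i !) (λ α → ⟦ i ≤ᵇ List.length (Xα φ h α) ⟧) (toList B))) ⟩
    ∑⁺ B (λ α → ⟦ i ≤ᵇ List.length (Xα φ h α) ⟧ * i !)
      ≤⟨ ∑-mono-≤ (toList B) tuplesInBucket ⟩
    ∑⁺ B (λ α → ∑⁺ (allVecs i Keys) (λ t → ⟦ distinctAll (inBucket α) (Vec.toList t) ⟧))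
      ≡⟨ ∑-comm (λ α t → ⟦ distinctAll (inBucket α) (Vec.toList t) ⟧) (toList B) (toList (allVecs i Keys)) ⟩
    ∑⁺ (allVecs i Keys) (λ t → ∑⁺ B (λ α → ⟦ distinctAll (inBucket α) (Vec.toList t) ⟧))
      ≤⟨ ∑-mono-≤ (toList (allVecs i Keys)) (λ t → ∑-bucket≤indepCollidingSelected t 𝒥) ⟩
    ∑⁺ (allVecs i Keys) (λ t → indepCollidingSelected φ t h)  ∎
    where
    open ≤-Reasoning
    i = suc n
    B = allBits k
    tuplesInBucket : ∀ α →
      ⟦ i ≤ᵇ List.length (Xα φ h α) ⟧ * i !
        ≤ ∑⁺ (allVecs i Keys) (λ t → ⟦ distinctAll (inBucket α) (Vec.toList t) ⟧)
    tuplesInBucket α with i ≤ᵇ List.length (Xα φ h α) in i≤|Xα|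
    ... | false = z≤n
    ... | true  = ≤-trans (≤-reflexive (+-identityʳ _))
                          (!≤∑-distinctAll Keys EachOnce-Keys i (inBucket α)
                            (≤-trans (≤ᵇ⇒≤ i _ (subst T (sym i≤|Xα|) tt)) (≤-reflexive (length-Xα α))))

∑-Sᵢ𝟏𝒥 : ∀ {k r c' d} (φ : Selector k r c') n →
  ∑⁺ (allTornado k r c' d) (λ h → S φ h (suc n) * 𝟏𝒥 φ h) * (suc n ! * ((2 ^ k) ^ n * (2 ^ r) ^ suc n))
    ≤ List⁺.length (allTornado k r c' d) * ∑ (allKeys k c') (selecting φ) ^ suc n
∑-Sᵢ𝟏𝒥 {k} {r} {c'} {d} φ n = begin
  ∑⁺ H (λ h → S φ h i * 𝟏𝒥 φ h) * (i ! * KR)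
    ≡⟨ trans (sym (*-assoc (∑⁺ H (λ h → S φ h i * 𝟏𝒥 φ h)) (i !) KR)) (cong (_* KR) (*-comm _ (i !))) ⟩
  i ! * ∑⁺ H (λ h → S φ h i * 𝟏𝒥 φ h) * KR
    ≡⟨ cong (_* KR) (sym (∑-*ˡ (i !) (λ h → S φ h i * 𝟏𝒥 φ h) (toList H))) ⟩
  ∑⁺ H (λ h → i ! * (S φ h i * 𝟏𝒥 φ h)) * KR
    ≤⟨ *-monoˡ-≤ KR (∑-mono-≤ (toList H) (λ h → Buckets.!*Sᵢ*𝟏𝒥≤∑indepCollidingSelected φ h n)) ⟩
  ∑⁺ H (λ h → ∑⁺ Tuples (λ t → indepCollidingSelected φ t h)) * KR
    ≡⟨ cong (_* KR) (∑-comm (λ h t → indepCollidingSelected φ t h) (toList H) (toList Tuples)) ⟩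
  ∑⁺ Tuples (λ t → ∑⁺ H (indepCollidingSelected φ t)) * KR
    ≡⟨ sym (∑-*ʳ KR (λ t → ∑⁺ H (indepCollidingSelected φ t)) (toList Tuples)) ⟩
  ∑⁺ Tuples (λ t → ∑⁺ H (indepCollidingSelected φ t) * KR)
    ≤⟨ ∑-mono-≤ (toList Tuples) (λ t → SelectedTuple.∑-indepCollidingSelected {d = d} φ t) ⟩
  ∑⁺ Tuples (λ t → List⁺.length H * prodSum (allBits r) (map (λ x v → ⟦ φ x v ⟧) t))
    ≡⟨ ∑-*ˡ (List⁺.length H) _ (toList Tuples) ⟩
  List⁺.length H * ∑⁺ Tuples (λ t → prodSum (allBits r) (map (λ x v → ⟦ φ x v ⟧) t))
    ≡⟨ cong (List⁺.length H *_) ∑-prodSum ⟩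
  List⁺.length H * ∑ (allKeys k c') (selecting φ) ^ i  ∎
  where
  open ≤-Reasoning
  i = suc n
  H = allTornado k r c' d
  Keys = allVecs (suc c') (allBits k)
  Tuples = allVecs i Keys
  KR = (2 ^ k) ^ n * (2 ^ r) ^ i
  ∑-prodSum : ∑⁺ Tuples (λ t → prodSum (allBits r) (map (λ x v → ⟦ φ x v ⟧) t))
              ≡ ∑ (allKeys k c') (selecting φ) ^ i
  ∑-prodSum = trans (∑-cong (toList Tuples) (prodSum-map (allBits r) (λ x v → ⟦ φ x v ⟧)))
                    (trans (∑-allVecs-prodApply i Keys (replicate i (selecting φ)))
                           (prodSum-replicate Keys (selecting φ) i))

^-distribʳ-* : ∀ a b n → (a * b) ^ n ≡ a ^ n * b ^ n
^-distribʳ-* a b zero    = refl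
^-distribʳ-* a b (suc n) = trans (cong (a * b *_) (^-distribʳ-* a b n)) (*-CS.interchange a b (a ^ n) (b ^ n))

-- 𝔼[Sᵢ 𝟏𝒥] ≤ μ̄ᵢ with denominators cleared: N counts the hash functions, Q = N 𝔼[Sᵢ 𝟏𝒥], M = N μ,
-- A = |ℛ| μ, B = |Σ|, C = |ℛ| and F = i!
cleared-bound : ∀ n Q M A N B C F .{{_ : NonZero C}} → M * C ≡ N * A →
  Q * (F * (B ^ n * C ^ suc n)) ≤ N * A ^ suc n →
  Q * ((N * B) ^ suc n * F) ≤ B * M ^ suc n * N
cleared-bound n Q M A N B C F M*C≡N*A bound = *-cancelʳ-≤ _ _ (C ^ suc n) {{m^n≢0 C (suc n)}} (begin
  Q * ((N * B) ^ suc n * F) * C ^ suc n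
    ≡⟨ cong (λ z → Q * (z * F) * C ^ suc n) (^-distribʳ-* N B (suc n)) ⟩
  Q * (N ^ suc n * (B * B ^ n) * F) * C ^ suc n
    ≡⟨ shuffle₁ Q (N ^ suc n) B (B ^ n) F (C ^ suc n) ⟩
  Q * (F * (B ^ n * C ^ suc n)) * (N ^ suc n * B)
    ≤⟨ *-monoˡ-≤ (N ^ suc n * B) bound ⟩
  N * A ^ suc n * (N ^ suc n * B)
    ≡⟨ shuffle₂ N (A ^ suc n) (N ^ suc n) B ⟩
  B * N * (N ^ suc n * A ^ suc n)
    ≡⟨ cong (B * N *_) (sym (^-distribʳ-* N A (suc n))) ⟩
  B * N * (N * A) ^ suc n
    ≡⟨ cong (λ z → B * N * z ^ suc n) (sym M*C≡N*A) ⟩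
  B * N * (M * C) ^ suc n
    ≡⟨ cong (B * N *_) (^-distribʳ-* M C (suc n)) ⟩
  B * N * (M ^ suc n * C ^ suc n)
    ≡⟨ shuffle₃ B N (M ^ suc n) (C ^ suc n) ⟩
  B * M ^ suc n * N * C ^ suc n  ∎)
  where
  open ≤-Reasoning
  shuffle₁ : ∀ q nⁱ b bⁿ f cⁱ → q * (nⁱ * (b * bⁿ) * f) * cⁱ ≡ q * (f * (bⁿ * cⁱ)) * (nⁱ * b)
  shuffle₁ = solve-∀
  shuffle₂ : ∀ n aⁱ nⁱ b → n * aⁱ * (nⁱ * b) ≡ b * n * (nⁱ * aⁱ)
  shuffle₂ = solve-∀
  shuffle₃ : ∀ b n mⁱ cⁱ → b * n * (mⁱ * cⁱ) ≡ b * mⁱ * n * cⁱ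
  shuffle₃ = solve-∀

infix 4 _≈_/_

_≈_/_ : ℚ → ℕ → ℕ → Set
q ≈ a / b = Σ ℚᵘ (λ p → toℚᵘ q U.≃ p × ↥ p ≡ ℤ.+ a × ↧ₙ p ≡ b)

≈-cong : ∀ {q a a' b b'} → a ≡ a' → b ≡ b' → q ≈ a / b → q ≈ a' / b'
≈-cong refl refl q≈a/b = q≈a/b

≈-/ : ∀ a d .{{_ : NonZero d}} → (ℤ.+ a) ℚ./ d ≈ a / d
≈-/ a (suc d) = mkℚᵘ (ℤ.+ a) d , ℚP.toℚᵘ-fromℚᵘ (mkℚᵘ (ℤ.+ a) d) , refl , refl

≈-* : ∀ {q q' a b c d} → q ≈ a / b → q' ≈ c / d → q ℚ.* q' ≈ (a * c) / (b * d)
≈-* {q} {q'} {a} {c = c} (p@(mkℚᵘ _ _) , q≃p , refl , refl) (p'@(mkℚᵘ _ _) , q'≃p' , refl , refl) =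
  p U.* p' , UP.≃-trans (ℚP.toℚᵘ-homo-* q q') (UP.*-cong q≃p q'≃p') , sym (ℤP.pos-* a c) , refl

≈-^ : ∀ {q a b} → q ≈ a / b → ∀ n → q ^ℚ n ≈ (a ^ n) / (b ^ n)
≈-^ q≈a/b zero    = mkℚᵘ (ℤ.+ 1) 0 , UP.≃-refl , refl , refl
≈-^ q≈a/b (suc n) = ≈-* q≈a/b (≈-^ q≈a/b n)

≈-≤ : ∀ {q q' a b c d} → q ≈ a / b → q' ≈ c / d → a * d ≤ c * b → q ≤ℚ q'
≈-≤ {a = a} {b} {c} {d} (mkℚᵘ _ _ , q≃p , refl , refl) (mkℚᵘ _ _ , q'≃p' , refl , refl) ad≤cb =
  ℚP.toℚᵘ-cancel-≤ (UP.≤-respˡ-≃ (UP.≃-sym q≃p) (UP.≤-respʳ-≃ (UP.≃-sym q'≃p')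
    (U.*≤* (subst₂ ℤ._≤_ (ℤP.pos-* a d) (ℤP.pos-* c b) (ℤ.+≤+ ad≤cb)))))

𝔼≈ : ∀ {Ω : Set} (ωs : List⁺ Ω) (F : Ω → ℕ) → 𝔼 ωs F ≈ ∑⁺ ωs F / List⁺.length ωs
𝔼≈ (ω ∷ ωs) F =
  ≈-cong (sum-map≡∑ F (ω ∷ ωs)) refl (≈-/ (sum (List.map F (ω ∷ ωs))) (suc (List.length ωs)))

lemma18 : (k r c' d : ℕ) (φ : Selector k r c') (i : ℕ) → 1 ≤ i →
    𝔼 (allTornado k r c' d) (λ h → S φ h i * 𝟏𝒥 φ h) ≤ℚ μ̄ k r c' d φ i
lemma18 k r c' d φ (suc n) _ =
  ≈-≤ (𝔼≈ H (λ h → S φ h i * 𝟏𝒥 φ h)) μ̄≈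
      (cleared-bound n Q M A N (2 ^ k) (2 ^ r) (i !) {{m^n≢0 2 r}}
                     (∑-length-Xset {d = d} φ) (∑-Sᵢ𝟏𝒥 {d = d} φ n))
  where
  i = suc n
  H = allTornado k r c' d
  N = List⁺.length H
  Q = ∑⁺ H (λ h → S φ h i * 𝟏𝒥 φ h)
  M = ∑⁺ H (λ h → List.length (Xset φ h))
  A = ∑ (allKeys k c') (selecting φ)
  f≈ : fval k r c' d φ ≈ (M * 1) / (N * 2 ^ k)
  f≈ = ≈-* (𝔼≈ H (λ h → List.length (Xset φ h))) (≈-/ 1 (2 ^ k) {{m^n≢0 2 k}})
  μ̄≈ : μ̄ k r c' d φ i ≈ (2 ^ k * M ^ i) / ((N * 2 ^ k) ^ i * i !)
  μ̄≈ = ≈-cong (trans (*-identityʳ (2 ^ k * (M * 1) ^ i)) (cong (λ m → 2 ^ k * m ^ i) (*-identityʳ M)))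
               (cong (_* i !) (*-identityˡ ((N * 2 ^ k) ^ i)))
         (≈-* (≈-* (≈-/ (2 ^ k) 1) (≈-^ f≈ i)) (≈-/ 1 (i !) {{i !≢0}}))
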